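{- Let $v$, $s$ and $\lambda$ be positive integers with $s\geq 3$, and let $M$ be a list of integers. Suppose there exists an $(M)$-packing of $\lambda K_v$ whose leave $L$ has a component $H$ containing an $(s+1)$-cycle with a chord. Then there exists an $(M)$-packing of $\lambda K_v$ with a leave $L'$ such that $E(L')=(E(L)\setminus E(H))\cup E(H')$, where $H'$ is a (multi)graph with $V(H')=V(H)$ and $|E(H')|=|E(H)|$ which contains an $(s,1)$-lasso. Furthermore, $\deg_{H'}(x)\geq \deg_H(x)$ for each vertex $x$ in the $s$-cycle of this lasso.
   Context: $\lambda K_v$ is the complete multigraph on $v$ vertices with $\lambda$ parallel edges between each pair of distinct vertices. An $m$-cycle ($m\geq 2$) has $m$ distinct vertices $x_0,\ldots,x_{m-1}$ and edges $x_ix_{i+1}$ (indices mod $m$); a 2-cycle is a pair of parallel edges. For a list $M=(m_1,\ldots,m_t)$, an $(M)$-packing of $\lambda K_v$ is a collection of $t$ submultigraphs of $\lambda K_v$ that are cycles of lengths $m_1,\ldots,m_t$ such that each edge of $\lambda K_v$ lies in at most one of them. The leave of a packing is the multigraph obtained from $\lambda K_v$ by removing all edges of the cycles in the packing. A chord of a cycle is an edge incident with two vertices of the cycle but not in the cycle (it may be parallel to an edge of the cycle). For $p\ge 2$, $q\ge1$, a $(p,q)$-lasso is the union of a $p$-cycle and a path with $q$ edges sharing exactly one vertex, which is an end-vertex of the path; its $p$-cycle is called the cycle of the lasso. -}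

module Defs where

open import Data.Nat using (ℕ; zero; suc; _+_; _*_; _∸_; _≤_; _<_; _<?_)
open import Data.Fin using (Fin; zero; suc; toℕ; fromℕ<; _≟_)
open import Data.List using (List; length; lookup)
open import Data.Product using (Σ; _×_; ∃; ∃₂; _,_)
open import Relation.Nullary using (Dec; yes; no; ¬_)
open import Relation.Binary.PropositionalEquality using (_≡_; _≢_)
open import Relation.Binary.Construct.Closure.ReflexiveTransitive using (Star)
open import Function.Definitions using (Injective)

-- A (loopless) multigraph on vertex set Fin v, given by edge multiplicities
-- of (ordered representations of) unordered pairs.
Graph : ℕ → Set
Graph v = Fin v → Fin v → ℕ

IsMultigraph : ∀ {v} → Graph v → Set
IsMultigraph {v} G = (∀ x y → G x y ≡ G y x) × (∀ x → G x x ≡ 0)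

_⊆_ : ∀ {v} → Graph v → Graph v → Set
G ⊆ H = ∀ x y → G x y ≤ H x y

sumFin : ∀ {n} → (Fin n → ℕ) → ℕ
sumFin {zero} f = 0
sumFin {suc n} f = f zero + sumFin (λ i → f (suc i))

ind : ∀ {A : Set} → Dec A → ℕ
ind (yes _) = 1
ind (no _) = 0

next : ∀ {n} → Fin (suc n) → Fin (suc n)
next {n} i with suc (toℕ i) <? suc n
... | yes p = fromℕ< p
... | no _ = zero

IsCycle : ∀ {v m} → (Fin m → Fin v) → Set
IsCycle {v} {m} c = (2 ≤ m) × Injective _≡_ _≡_ c

cycMult : ∀ {v m} → (Fin m → Fin v) → Graph v
cycMult {m = zero} c a b = 0
cycMult {m = suc k} c a b =
  sumFin (λ i → ind (c i ≟ a) * ind (c (next i) ≟ b) + ind (c i ≟ b) * ind (c (next i) ≟ a))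

complete : (v l : ℕ) → Graph v
complete v l x y with x ≟ y
... | yes _ = 0
... | no _ = l

usedBy : ∀ {v} (M : List ℕ) → ((i : Fin (length M)) → Fin (lookup M i) → Fin v) → Graph v
usedBy M cyc x y = sumFin (λ i → cycMult (cyc i) x y)

record Packing (v l : ℕ) (M : List ℕ) : Set where
  field
    cyc      : (i : Fin (length M)) → Fin (lookup M i) → Fin v
    isCyc    : ∀ i → IsCycle (cyc i)
    disjoint : usedBy M cyc ⊆ complete v l

leave : ∀ {v l M} → Packing v l M → Graph v
leave {v} {l} {M} P x y = complete v l x y ∸ usedBy M (Packing.cyc P) x y

Adj : ∀ {v} → Graph v → Fin v → Fin v → Set
Adj G x y = 0 < G x y

Reach : ∀ {v} → Graph v → Fin v → Fin v → Set
Reach G = Star (Adj G)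

IsComponent : ∀ {v} → Graph v → Graph v → Fin v → Set
IsComponent L H x0 =
  ∀ x y → (Reach L x0 x → H x y ≡ L x y) × (¬ Reach L x0 x → H x y ≡ 0)

edgeCount : ∀ {v} → Graph v → ℕ
edgeCount G = sumFin (λ x → sumFin (λ y → ind (toℕ x <? toℕ y) * G x y))

deg : ∀ {v} → Graph v → Fin v → ℕ
deg G x = sumFin (λ y → G x y)

HasChordedCycle : ∀ {v} → Graph v → ℕ → Set
HasChordedCycle {v} G k =
  Σ (Fin k → Fin v) λ c → IsCycle c × (cycMult c ⊆ G) ×
    ∃₂ λ i j → cycMult c (c i) (c j) < G (c i) (c j)

IsLassoIn : ∀ {v s} → Graph v → (Fin s → Fin v) → Fin s → Fin v → Set
IsLassoIn G c j w = IsCycle c × (cycMult c ⊆ G) × (∀ i → c i ≢ w) × (1 ≤ G (c j) w)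

-- Write the (s+1)-cycle as z0 z1 z2 ⋯ with the chord z1 t. If the leave has an edge z0 z2 besides the
-- cycle, then z0 z2 ⋯ is an s-cycle with pendant edge z0 z1: a lasso, and the packing is unchanged.
-- Otherwise z2 z0 is not in the leave while z1 z0 is, and switching z1 and z2 with respect to z0 in the
-- packing (interchanging z1 and z2 along an alternating trail of cycles) either yields the s-cycle
-- z0 z2 z3 ⋯ with pendant edge z2 z1, or interchanges z1 and z2 on the cycle. The latter moves t one
-- step closer to z1, so eventually the chord joins vertices at distance 2; a chord parallel to a cycle
-- edge becomes such a chord after one switch. A switch changes the leave only on edges inside the
-- component H, keeps its number of edges, and does not lower the degrees on the final s-cycle.

module Submission where

open import Defs
open import Data.Bool using (Bool; true; false; not; _∨_; _∧_)
import Data.Bool as Bool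
open import Data.Bool.Properties using (not-involutive; not-¬)
open import Data.Empty using (⊥; ⊥-elim)
open import Data.Fin using (Fin; zero; suc; toℕ; _≟_; inject₁; fromℕ; cast)
open import Data.Fin.Properties using (toℕ-injective; toℕ-inject₁; toℕ-fromℕ; toℕ-fromℕ<; toℕ<n; cast-is-id; cast-involutive)
  renaming (suc-injective to Fin-suc-injective)
open import Data.List using (List; []; _∷_; _++_; [_]; length; lookup; tabulate; reverse)
open import Data.List.Properties using (++-assoc; tabulate-lookup; tabulate-cong; reverse-++; length-tabulate; ++-identityʳ; length-++; unfold-reverse)
open import Data.List.Membership.Propositional using (_∈_; _∉_)
open import Data.List.Membership.Propositional.Properties using (∈-++⁺ˡ; ∈-++⁺ʳ; ∈-++⁻; ∈-tabulate⁻; ∈-tabulate⁺; ∈-lookup; ∈-∃++)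
open import Data.List.Relation.Unary.Any using (here; there)
open import Data.List.Relation.Binary.Permutation.Propositional using (_↭_; ↭-sym; ↭-refl)
import Data.List.Relation.Binary.Permutation.Propositional as P
open import Data.List.Relation.Binary.Permutation.Propositional.Properties using (∈-resp-↭; ↭-length; ↭-reverse; ++⁺ˡ; ++⁺ʳ; ++-comm)
open import Data.Nat using (ℕ; zero; suc; _+_; _*_; _∸_; _≤_; _<_; z≤n; s≤s; _<?_; _≤?_)
open import Data.Nat.Properties hiding (_≟_)
open import Data.Nat.Tactic.RingSolver using (solve-∀)
open import Data.Product using (Σ; _×_; ∃; ∃₂; _,_; proj₁; proj₂)
open import Data.Sum using (_⊎_; inj₁; inj₂)
open import Data.Unit using (⊤)
open import Function.Definitions using (Injective)
open import Relation.Binary.Construct.Closure.ReflexiveTransitive using (Star; ε; _◅_; _◅◅_)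
open import Relation.Binary.Definitions using (tri<; tri≈; tri>)
open import Relation.Binary.PropositionalEquality using (_≡_; refl; sym; trans; cong; cong₂; subst; subst₂; _≢_; module ≡-Reasoning)
open import Relation.Nullary using (Dec; yes; no; ¬_)
open import Relation.Nullary.Decidable using (⌊_⌋)

-- Multigraphs, paths and closed walks

ind-yes : ∀ {A : Set} (d : Dec A) → A → ind d ≡ 1
ind-yes (yes _) _ = refl
ind-yes (no ¬a) a = ⊥-elim (¬a a)

ind-no : ∀ {A : Set} (d : Dec A) → ¬ A → ind d ≡ 0
ind-no (yes a) ¬a = ⊥-elim (¬a a)
ind-no (no _) _ = refl

sumFin-cong : ∀ {n} {f g : Fin n → ℕ} → (∀ i → f i ≡ g i) → sumFin f ≡ sumFin g
sumFin-cong {zero} h = refl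
sumFin-cong {suc n} h = cong₂ _+_ (h zero) (sumFin-cong (λ i → h (suc i)))

sumFin-+ : ∀ {n} (f g : Fin n → ℕ) → sumFin (λ i → f i + g i) ≡ sumFin f + sumFin g
sumFin-+ {zero} f g = refl
sumFin-+ {suc n} f g rewrite sumFin-+ (λ i → f (suc i)) (λ i → g (suc i)) = interchange (f zero) (g zero) _ _
  where
  interchange : ∀ a b c d → a + b + (c + d) ≡ a + c + (b + d)
  interchange = solve-∀

sumFin-0 : ∀ {n} → sumFin {n} (λ _ → 0) ≡ 0
sumFin-0 {zero} = refl
sumFin-0 {suc n} = sumFin-0 {n}

sumFin-mono : ∀ {n} {f g : Fin n → ℕ} → (∀ i → f i ≤ g i) → sumFin f ≤ sumFin g
sumFin-mono {zero} h = z≤n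
sumFin-mono {suc n} h = +-mono-≤ (h zero) (sumFin-mono (λ i → h (suc i)))

sumFin-δ : ∀ {n} (x : Fin n) (f : Fin n → ℕ) → sumFin (λ i → ind (x ≟ i) * f i) ≡ f x
sumFin-δ {suc n} zero f = begin
  1 * f zero + sumFin (λ i → ind (zero ≟ suc i) * f (suc i))
    ≡⟨ cong (1 * f zero +_) (sumFin-cong (λ i → cong (_* f (suc i)) (ind-no (zero ≟ suc i) λ ()))) ⟩
  1 * f zero + sumFin {n} (λ _ → 0)
    ≡⟨ cong₂ _+_ (*-identityˡ (f zero)) (sumFin-0 {n}) ⟩
  f zero + 0
    ≡⟨ +-identityʳ (f zero) ⟩
  f zero ∎
  where open ≡-Reasoning
sumFin-δ {suc n} (suc x) f =
  cong₂ _+_ (cong (_* f zero) (ind-no (suc x ≟ zero) λ ()))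
            (trans (sumFin-cong (λ i → cong (_* f (suc i)) (ind-suc i))) (sumFin-δ x (λ i → f (suc i))))
  where
  ind-suc : ∀ i → ind (suc x ≟ suc i) ≡ ind (x ≟ i)
  ind-suc i with x ≟ i
  ... | yes _ = refl
  ... | no _ = refl

sumFin-last : ∀ {n} (f : Fin (suc n) → ℕ) → sumFin f ≡ sumFin (λ i → f (inject₁ i)) + f (fromℕ n)
sumFin-last {zero} f = +-comm (f zero) 0
sumFin-last {suc n} f rewrite sumFin-last {n} (λ i → f (suc i)) = sym (+-assoc (f zero) _ _)

next-inject₁ : ∀ {n} (i : Fin n) → next (inject₁ i) ≡ suc i
next-inject₁ {n} i with suc (toℕ (inject₁ i)) <? suc n
... | yes p = toℕ-injective (trans (toℕ-fromℕ< p) (cong suc (toℕ-inject₁ i)))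
... | no ¬p = ⊥-elim (¬p (s≤s (subst (_< n) (sym (toℕ-inject₁ i)) (toℕ<n i))))

next-fromℕ : ∀ n → next (fromℕ n) ≡ zero
next-fromℕ n with suc (toℕ (fromℕ n)) <? suc n
... | yes p = ⊥-elim (<-irrefl refl (subst (λ k → suc k < suc n) (toℕ-fromℕ n) p))
... | no _ = refl

module _ {v : ℕ} where

  edge : Fin v → Fin v → Graph v
  edge x y p q = ind (x ≟ p) * ind (y ≟ q) + ind (x ≟ q) * ind (y ≟ p)

  infixl 6 _⊕_
  _⊕_ : Graph v → Graph v → Graph v
  (G ⊕ K) x y = G x y + K x y

  ∅G : Graph v
  ∅G _ _ = 0

  infix 4 _≈_
  _≈_ : Graph v → Graph v → Set
  G ≈ K = ∀ x y → G x y ≡ K x y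

  edge-comm : ∀ x y p q → edge x y p q ≡ edge y x p q
  edge-comm x y p q = swap (ind (x ≟ p)) (ind (y ≟ q)) (ind (x ≟ q)) (ind (y ≟ p))
    where
    swap : ∀ a b c d → a * b + c * d ≡ d * c + b * a
    swap = solve-∀

  edge-sym : ∀ x y p q → edge x y p q ≡ edge x y q p
  edge-sym x y p q = +-comm (ind (x ≟ p) * ind (y ≟ q)) _

  edge-≡0 : ∀ {x y p q} → (x ≢ p ⊎ y ≢ q) → (x ≢ q ⊎ y ≢ p) → edge x y p q ≡ 0
  edge-≡0 {x} {y} {p} {q} h1 h2 = cong₂ _+_ (product-≡0 (x ≟ p) (y ≟ q) h1) (product-≡0 (x ≟ q) (y ≟ p) h2)
    where
    product-≡0 : ∀ {A B : Set} (a : Dec A) (b : Dec B) → ¬ A ⊎ ¬ B → ind a * ind b ≡ 0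
    product-≡0 a b (inj₁ ¬A) rewrite ind-no a ¬A = refl
    product-≡0 a b (inj₂ ¬B) rewrite ind-no b ¬B = *-zeroʳ (ind a)

  edge-≡1 : ∀ {x y} → x ≢ y → edge x y x y ≡ 1
  edge-≡1 {x} {y} n rewrite ind-yes (x ≟ x) refl | ind-yes (y ≟ y) refl | ind-no (x ≟ y) n = refl

  edge-ends : ∀ {x y p q} → 0 < edge x y p q → (x ≡ p × y ≡ q) ⊎ (x ≡ q × y ≡ p)
  edge-ends {x} {y} {p} {q} h with x ≟ p | y ≟ q | x ≟ q | y ≟ p
  ... | yes a | yes b | _ | _ = inj₁ (a , b)
  ... | _ | _ | yes a | yes b = inj₂ (a , b)
  ... | yes a | no b | no c | _ = ⊥-elim (<-irrefl refl h)
  ... | yes a | no b | yes c | no d = ⊥-elim (<-irrefl refl h)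
  ... | no a | _ | no c | _ = ⊥-elim (<-irrefl refl h)
  ... | no a | _ | yes c | no d = ⊥-elim (<-irrefl refl h)

  edge-view : ∀ x y p q → edge x y p q ≡ 0 ⊎ (x ≡ p × y ≡ q) ⊎ (x ≡ q × y ≡ p)
  edge-view x y p q with edge x y p q in e
  ... | zero = inj₁ refl
  ... | suc _ = inj₂ (edge-ends (subst (0 <_) (sym e) (s≤s z≤n)))

  pathG : List (Fin v) → Graph v
  pathG [] = ∅G
  pathG (x ∷ []) = ∅G
  pathG (x ∷ y ∷ r) = edge x y ⊕ pathG (y ∷ r)

  cycleG : List (Fin v) → Graph v
  cycleG [] = ∅G
  cycleG (x ∷ r) = pathG (x ∷ r ++ [ x ])

  pathG-tabulate : ∀ {k} (f : Fin (suc k) → Fin v) (z : Fin v) a b →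
    pathG (tabulate f ++ [ z ]) a b ≡ sumFin (λ i → edge (f (inject₁ i)) (f (suc i)) a b) + edge (f (fromℕ k)) z a b
  pathG-tabulate {zero} f z a b = +-identityʳ _
  pathG-tabulate {suc k} f z a b rewrite pathG-tabulate {k} (λ i → f (suc i)) z a b =
    sym (+-assoc (edge (f zero) (f (suc zero)) a b) _ _)

  cycMult≈cycleG : ∀ {m} (c : Fin m → Fin v) → cycMult c ≈ cycleG (tabulate c)
  cycMult≈cycleG {zero} c a b = refl
  cycMult≈cycleG {suc k} c a b = begin
    sumFin (λ i → edge (c i) (c (next i)) a b)
      ≡⟨ sumFin-last (λ i → edge (c i) (c (next i)) a b) ⟩
    sumFin (λ i → edge (c (inject₁ i)) (c (next (inject₁ i))) a b) + edge (c (fromℕ k)) (c (next (fromℕ k))) a b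
      ≡⟨ cong₂ _+_ (sumFin-cong (λ i → cong (λ t → edge (c (inject₁ i)) (c t) a b) (next-inject₁ i)))
                   (cong (λ t → edge (c (fromℕ k)) (c t) a b) (next-fromℕ k)) ⟩
    sumFin (λ i → edge (c (inject₁ i)) (c (suc i)) a b) + edge (c (fromℕ k)) (c zero) a b
      ≡⟨ sym (pathG-tabulate c (c zero) a b) ⟩
    cycleG (tabulate c) a b ∎
    where open ≡-Reasoning

  pathG-++ : ∀ l1 x l2 → pathG (l1 ++ x ∷ l2) ≈ pathG (l1 ++ [ x ]) ⊕ pathG (x ∷ l2)
  pathG-++ [] x l2 p q = refl
  pathG-++ (y ∷ []) x l2 p q = sym (+-assoc (edge y x p q) 0 _)
  pathG-++ (y ∷ y' ∷ l1) x l2 p q rewrite pathG-++ (y' ∷ l1) x l2 p q = sym (+-assoc (edge y y' p q) _ _)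

  cycleG-rotate₁ : ∀ x r → cycleG (x ∷ r) ≈ cycleG (r ++ [ x ])
  cycleG-rotate₁ x [] p q = refl
  cycleG-rotate₁ x (y ∷ r) p q = begin
    edge x y p q + pathG (y ∷ r ++ [ x ]) p q
      ≡⟨ +-comm (edge x y p q) _ ⟩
    pathG (y ∷ r ++ [ x ]) p q + edge x y p q
      ≡⟨ cong (pathG (y ∷ r ++ [ x ]) p q +_) (sym (+-identityʳ _)) ⟩
    pathG (y ∷ r ++ [ x ]) p q + pathG (x ∷ [ y ]) p q
      ≡⟨ sym (pathG-++ (y ∷ r) x [ y ] p q) ⟩
    pathG (y ∷ r ++ x ∷ [ y ]) p q
      ≡⟨ cong (λ t → pathG t p q) (sym (++-assoc (y ∷ r) [ x ] [ y ])) ⟩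
    cycleG (y ∷ r ++ [ x ]) p q ∎
    where open ≡-Reasoning

  cycleG-rotate : ∀ l1 l2 → cycleG (l1 ++ l2) ≈ cycleG (l2 ++ l1)
  cycleG-rotate [] l2 p q rewrite ++-identityʳ l2 = refl
  cycleG-rotate (x ∷ l1) l2 p q = begin
    cycleG (x ∷ l1 ++ l2) p q            ≡⟨ cycleG-rotate₁ x (l1 ++ l2) p q ⟩
    cycleG ((l1 ++ l2) ++ [ x ]) p q     ≡⟨ cong (λ t → cycleG t p q) (++-assoc l1 l2 [ x ]) ⟩
    cycleG (l1 ++ l2 ++ [ x ]) p q       ≡⟨ cycleG-rotate l1 (l2 ++ [ x ]) p q ⟩
    cycleG ((l2 ++ [ x ]) ++ l1) p q     ≡⟨ cong (λ t → cycleG t p q) (++-assoc l2 [ x ] l1) ⟩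
    cycleG (l2 ++ x ∷ l1) p q            ∎
    where open ≡-Reasoning

  pathG-reverse : ∀ l → pathG (reverse l) ≈ pathG l
  pathG-reverse [] p q = refl
  pathG-reverse (x ∷ []) p q = refl
  pathG-reverse (x ∷ y ∷ l) p q = begin
    pathG (reverse (x ∷ y ∷ l)) p q
      ≡⟨ cong (λ t → pathG t p q) (trans (unfold-reverse x (y ∷ l)) (cong (_++ [ x ]) (unfold-reverse y l))) ⟩
    pathG ((reverse l ++ [ y ]) ++ [ x ]) p q
      ≡⟨ cong (λ t → pathG t p q) (++-assoc (reverse l) [ y ] [ x ]) ⟩
    pathG (reverse l ++ y ∷ [ x ]) p q
      ≡⟨ pathG-++ (reverse l) y [ x ] p q ⟩
    pathG (reverse l ++ [ y ]) p q + (edge y x p q + 0)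
      ≡⟨ cong₂ _+_ (trans (cong (λ t → pathG t p q) (sym (unfold-reverse y l))) (pathG-reverse (y ∷ l) p q))
                   (+-identityʳ (edge y x p q)) ⟩
    pathG (y ∷ l) p q + edge y x p q
      ≡⟨ +-comm (pathG (y ∷ l) p q) (edge y x p q) ⟩
    edge y x p q + pathG (y ∷ l) p q
      ≡⟨ cong (_+ pathG (y ∷ l) p q) (edge-comm y x p q) ⟩
    pathG (x ∷ y ∷ l) p q ∎
    where open ≡-Reasoning

  pathG-sym : ∀ l p q → pathG l p q ≡ pathG l q p
  pathG-sym [] p q = refl
  pathG-sym (x ∷ []) p q = refl
  pathG-sym (x ∷ y ∷ r) p q = cong₂ _+_ (edge-sym x y p q) (pathG-sym (y ∷ r) p q)

  cycleG-sym : ∀ l p q → cycleG l p q ≡ cycleG l q p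
  cycleG-sym [] p q = refl
  cycleG-sym (x ∷ r) p q = pathG-sym (x ∷ r ++ [ x ]) p q

  pathG-∉ˡ : ∀ {x} l → x ∉ l → ∀ y → pathG l x y ≡ 0
  pathG-∉ˡ [] n y = refl
  pathG-∉ˡ (a ∷ []) n y = refl
  pathG-∉ˡ {x} (a ∷ b ∷ r) n y =
    cong₂ _+_ (edge-≡0 (inj₁ (λ e → n (here (sym e)))) (inj₂ (λ e → n (there (here (sym e))))))
              (pathG-∉ˡ (b ∷ r) (λ m → n (there m)) y)

  pathG-∉ʳ : ∀ {x} l → x ∉ l → ∀ y → pathG l y x ≡ 0
  pathG-∉ʳ l n y = trans (pathG-sym l y _) (pathG-∉ˡ l n y)

  ∉-∷ʳ : ∀ {x h : Fin v} r → x ∉ h ∷ r → x ∉ h ∷ r ++ [ h ]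
  ∉-∷ʳ r n (here e) = n (here e)
  ∉-∷ʳ r n (there m) with ∈-++⁻ r m
  ... | inj₁ m' = n (there m')
  ... | inj₂ (here e) = n (here e)

  cycleG-∉ˡ : ∀ {x} l → x ∉ l → ∀ y → cycleG l x y ≡ 0
  cycleG-∉ˡ [] n y = refl
  cycleG-∉ˡ (h ∷ r) n y = pathG-∉ˡ (h ∷ r ++ [ h ]) (∉-∷ʳ r n) y

  cycleG-∉ʳ : ∀ {x} l → x ∉ l → ∀ y → cycleG l y x ≡ 0
  cycleG-∉ʳ l n y = trans (cycleG-sym l y _) (cycleG-∉ˡ l n y)

sumFin-scale : ∀ {n} c (f : Fin n → ℕ) → sumFin (λ i → c * f i) ≡ c * sumFin f
sumFin-scale {zero} c f = sym (*-zeroʳ c)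
sumFin-scale {suc n} c f rewrite sumFin-scale c (λ i → f (suc i)) = sym (*-distribˡ-+ c (f zero) _)

sumFin-scaled-δ : ∀ {n} c (t : Fin n) (f : Fin n → ℕ) → sumFin (λ y → c * (ind (t ≟ y) * f y)) ≡ c * f t
sumFin-scaled-δ c t f = trans (sumFin-scale c (λ y → ind (t ≟ y) * f y)) (cong (c *_) (sumFin-δ t f))

module _ {v : ℕ} where

  edgeCount-cong : ∀ {G K : Graph v} → G ≈ K → edgeCount G ≡ edgeCount K
  edgeCount-cong h = sumFin-cong (λ x → sumFin-cong (λ y → cong (ind (toℕ x <? toℕ y) *_) (h x y)))

  edgeCount-⊕ : ∀ (G K : Graph v) → edgeCount (G ⊕ K) ≡ edgeCount G + edgeCount K
  edgeCount-⊕ G K = trans (sumFin-cong (λ x → trans (sumFin-cong (λ y → *-distribˡ-+ (ind (toℕ x <? toℕ y)) (G x y) (K x y)))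
                                   (sumFin-+ {n = v} _ _)))
                      (sumFin-+ {n = v} _ _)

  deg-⊕ : ∀ (G K : Graph v) x → deg (G ⊕ K) x ≡ deg G x + deg K x
  deg-⊕ G K x = sumFin-+ {n = v} _ _

  deg-cong : ∀ {G K : Graph v} → G ≈ K → ∀ x → deg G x ≡ deg K x
  deg-cong h x = sumFin-cong (λ y → h x y)

  deg-edge : ∀ (u t z : Fin v) → deg (edge u t) z ≡ ind (u ≟ z) + ind (t ≟ z)
  deg-edge u t z = trans (sumFin-+ {n = v} _ _) (cong₂ _+_ (one u t) (trans (sumFin-cong (λ y → *-comm (ind (u ≟ y)) _)) (one t u)))
    where
    one : ∀ a b → sumFin (λ y → ind (a ≟ z) * ind (b ≟ y)) ≡ ind (a ≟ z)
    one a b = trans (sumFin-cong (λ y → cong (ind (a ≟ z) *_) (sym (*-identityʳ (ind (b ≟ y))))))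
                    (trans (sumFin-scaled-δ (ind (a ≟ z)) b (λ _ → 1)) (*-identityʳ (ind (a ≟ z))))

  -- exactly one of the ordered pairs (u, t), (t, u) is counted by edgeCount
  edgeCount-edge : ∀ (u t : Fin v) → u ≢ t → edgeCount (edge u t) ≡ 1
  edgeCount-edge u t ne = trans (sumFin-cong row) (trans (sumFin-+ {n = v} _ _)
      (trans (cong₂ _+_ (sumFin-δ u (λ x → ind (toℕ x <? toℕ t))) (sumFin-δ t (λ x → ind (toℕ x <? toℕ u)))) one-orientation))
    where
    distribute : ∀ (c a b d e : ℕ) → c * (a * b + d * e) ≡ a * (b * c) + e * (d * c)
    distribute = solve-∀
    row : ∀ x → sumFin (λ y → ind (toℕ x <? toℕ y) * edge u t x y) ≡ ind (u ≟ x) * ind (toℕ x <? toℕ t) + ind (t ≟ x) * ind (toℕ x <? toℕ u)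
    row x = trans (sumFin-cong (λ y → distribute (ind (toℕ x <? toℕ y)) (ind (u ≟ x)) (ind (t ≟ y)) (ind (u ≟ y)) (ind (t ≟ x))))
              (trans (sumFin-+ {n = v} _ _)
                (cong₂ _+_ (sumFin-scaled-δ (ind (u ≟ x)) t (λ y → ind (toℕ x <? toℕ y)))
                           (sumFin-scaled-δ (ind (t ≟ x)) u (λ y → ind (toℕ x <? toℕ y)))))
    one-orientation : ind (toℕ u <? toℕ t) + ind (toℕ t <? toℕ u) ≡ 1
    one-orientation with <-cmp (toℕ u) (toℕ t)
    ... | tri< p _ _ rewrite ind-yes (toℕ u <? toℕ t) p | ind-no (toℕ t <? toℕ u) (<⇒≯ p) = refl
    ... | tri> _ _ p rewrite ind-yes (toℕ t <? toℕ u) p | ind-no (toℕ u <? toℕ t) (<⇒≯ p) = refl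
    ... | tri≈ _ e _ = ⊥-elim (ne (toℕ-injective e))

length-remove : ∀ {A : Set} {n} (xs : List A) x ys → length (xs ++ x ∷ ys) ≡ suc n → length (xs ++ ys) ≡ n
length-remove xs x ys e = suc-injective (begin
  suc (length (xs ++ ys))          ≡⟨ cong suc (length-++ xs) ⟩
  suc (length xs + length ys)      ≡⟨ sym (+-suc (length xs) (length ys)) ⟩
  length xs + length (x ∷ ys)      ≡⟨ sym (length-++ xs) ⟩
  length (xs ++ x ∷ ys)            ≡⟨ e ⟩
  suc _                            ∎)
  where open ≡-Reasoning

module _ {A : Set} where

  data Distinct : List A → Set where
    []ᵈ : Distinct []
    _∷ᵈ_ : ∀ {x xs} → x ∉ xs → Distinct xs → Distinct (x ∷ xs)

  Distinct-head : ∀ {x xs} → Distinct (x ∷ xs) → x ∉ xs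
  Distinct-head (n ∷ᵈ _) = n

  Distinct-tail : ∀ {x xs} → Distinct (x ∷ xs) → Distinct xs
  Distinct-tail (_ ∷ᵈ d) = d

  Distinct-↭ : ∀ {xs ys} → xs ↭ ys → Distinct xs → Distinct ys
  Distinct-↭ P.refl d = d
  Distinct-↭ (P.prep x p) (n ∷ᵈ d) = (λ m → n (∈-resp-↭ (↭-sym p) m)) ∷ᵈ Distinct-↭ p d
  Distinct-↭ (P.swap x y p) (n1 ∷ᵈ (n2 ∷ᵈ d)) =
    (λ { (here e) → n1 (here (sym e)) ; (there m) → n2 (∈-resp-↭ (↭-sym p) m) })
    ∷ᵈ ((λ m → n1 (there (∈-resp-↭ (↭-sym p) m))) ∷ᵈ Distinct-↭ p d)
  Distinct-↭ (P.trans p q) d = Distinct-↭ q (Distinct-↭ p d)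

  Distinct-middle : ∀ P1 {x P2} → Distinct (P1 ++ x ∷ P2) → x ∉ P1 × x ∉ P2
  Distinct-middle [] (n ∷ᵈ d) = (λ ()) , n
  Distinct-middle (y ∷ P1) {x} (n ∷ᵈ d) =
    (λ { (here e) → n (subst (λ t → t ∈ P1 ++ x ∷ _) e (∈-++⁺ʳ P1 (here refl))) ; (there m) → proj₁ (Distinct-middle P1 d) m }) ,
    proj₂ (Distinct-middle P1 d)

  Distinct-tabulate : ∀ {n} (c : Fin n → A) → Injective _≡_ _≡_ c → Distinct (tabulate c)
  Distinct-tabulate {zero} c inj = []ᵈ
  Distinct-tabulate {suc n} c inj =
    (λ m → let (i , e) = ∈-tabulate⁻ m in zero≢suc (inj e))
    ∷ᵈ Distinct-tabulate (λ i → c (suc i)) (λ e → Fin-suc-injective (inj e))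
    where
    zero≢suc : ∀ {i : Fin n} → zero ≢ suc i
    zero≢suc ()

  lookup-injective : ∀ l → Distinct l → ∀ i j → lookup l i ≡ lookup l j → i ≡ j
  lookup-injective (x ∷ l) d zero zero e = refl
  lookup-injective (x ∷ l) (n ∷ᵈ d) zero (suc j) e = ⊥-elim (n (subst (_∈ l) (sym e) (∈-lookup j)))
  lookup-injective (x ∷ l) (n ∷ᵈ d) (suc i) zero e = ⊥-elim (n (subst (_∈ l) e (∈-lookup i)))
  lookup-injective (x ∷ l) (n ∷ᵈ d) (suc i) (suc j) e = cong suc (lookup-injective l d i j e)

  seqOf : ∀ {m} (l : List A) → length l ≡ m → Fin m → A
  seqOf l eq j = lookup l (cast (sym eq) j)

  tabulate-seqOf : ∀ {m} (l : List A) (eq : length l ≡ m) → tabulate (seqOf l eq) ≡ l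
  tabulate-seqOf l refl = trans (tabulate-cong (λ j → cong (lookup l) (cast-is-id refl j))) (tabulate-lookup l)

  seqOf-injective : ∀ {m} (l : List A) (eq : length l ≡ m) → Distinct l → Injective _≡_ _≡_ (seqOf l eq)
  seqOf-injective l refl d {i} {j} e =
    trans (sym (cast-is-id refl i)) (trans (lookup-injective l d _ _ e) (cast-is-id refl j))

  seqOf-∈ : ∀ {m} (l : List A) (eq : length l ≡ m) j → seqOf l eq j ∈ l
  seqOf-∈ l eq j = ∈-lookup _

cycMult-seqOf : ∀ {v m} (l : List (Fin v)) (eq : length l ≡ m) → cycMult (seqOf l eq) ≈ cycleG l
cycMult-seqOf l eq a b = trans (cycMult≈cycleG (seqOf l eq) a b) (cong (λ t → cycleG t a b) (tabulate-seqOf l eq))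

lastOf : ∀ {A : Set} → A → List A → A
lastOf h [] = h
lastOf h (x ∷ xs) = lastOf x xs

lastOf-∈ : ∀ {A : Set} (h : A) xs → lastOf h xs ∈ h ∷ xs
lastOf-∈ h [] = here refl
lastOf-∈ h (x ∷ xs) = there (lastOf-∈ x xs)

lastOf-∷ʳ : ∀ {A : Set} (h : A) xs t → lastOf h (xs ++ [ t ]) ≡ t
lastOf-∷ʳ h [] t = refl
lastOf-∷ʳ h (x ∷ xs) t = lastOf-∷ʳ x xs t

-- Leaves of packings

cycMult-sym : ∀ {v m} (c : Fin m → Fin v) p q → cycMult c p q ≡ cycMult c q p
cycMult-sym {m = zero} c p q = refl
cycMult-sym {m = suc k} c p q = sumFin-cong (λ i → edge-sym (c i) (c (next i)) p q)

usedBy-sym : ∀ {v} M cyc (p q : Fin v) → usedBy M cyc p q ≡ usedBy M cyc q p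
usedBy-sym M cyc p q = sumFin-cong (λ i → cycMult-sym (cyc i) p q)

complete-sym : ∀ v l (p q : Fin v) → complete v l p q ≡ complete v l q p
complete-sym v l p q with p ≟ q | q ≟ p
... | yes _ | yes _ = refl
... | no _ | no _ = refl
... | yes e | no n = ⊥-elim (n (sym e))
... | no n | yes e = ⊥-elim (n (sym e))

complete-≢ : ∀ v l (p q : Fin v) → p ≢ q → complete v l p q ≡ l
complete-≢ v l p q n with p ≟ q
... | yes e = ⊥-elim (n e)
... | no _ = refl

complete-diag : ∀ v l (p : Fin v) → complete v l p p ≡ 0
complete-diag v l p with p ≟ p
... | yes _ = refl
... | no n = ⊥-elim (n refl)

leave-exchange : ∀ k u u' x y → u ≤ k → u' ≤ k → u' + x ≡ u + y → (k ∸ u') + y ≡ (k ∸ u) + x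
leave-exchange k u u' x y u≤k u'≤k e = +-cancelʳ-≡ (u' + x) _ _ (begin
  k ∸ u' + y + (u' + x)   ≡⟨ regroup (k ∸ u') y u' x ⟩
  k ∸ u' + u' + y + x     ≡⟨ cong (λ t → t + y + x) (m∸n+n≡m u'≤k) ⟩
  k + y + x               ≡⟨ trans (+-assoc k y x) (trans (cong (k +_) (+-comm y x)) (sym (+-assoc k x y))) ⟩
  k + x + y               ≡⟨ cong (λ t → t + x + y) (sym (m∸n+n≡m u≤k)) ⟩
  k ∸ u + u + x + y       ≡⟨ regroup′ (k ∸ u) u x y ⟩
  k ∸ u + x + (u + y)     ≡⟨ cong (k ∸ u + x +_) (sym e) ⟩
  k ∸ u + x + (u' + x)    ∎)
  where
  open ≡-Reasoning
  regroup : ∀ (a b c d : ℕ) → a + b + (c + d) ≡ a + c + b + d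
  regroup = solve-∀
  regroup′ : ∀ (a b c d : ℕ) → a + b + c + d ≡ a + c + (b + d)
  regroup′ = solve-∀

leave-sym : ∀ {v l M} (P : Packing v l M) p q → leave P p q ≡ leave P q p
leave-sym {v} {l} {M} P p q = cong₂ _∸_ (complete-sym v l p q) (usedBy-sym M (Packing.cyc P) p q)

leave-diag : ∀ {v l M} (P : Packing v l M) p → leave P p p ≡ 0
leave-diag {v} {l} {M} P p rewrite complete-diag v l p = 0∸n≡0 (usedBy M (Packing.cyc P) p p)

-- Segments of the cycles of a packing at two poles

≢not : ∀ ℓ → ℓ ≢ not ℓ
≢not true ()
≢not false ()

-- A cycle through the poles a, b is cut at a and b into arcs; the ends of the arcs, which lie off {a, b},
-- are recorded as segments, each end tagged with the pole it is attached to (true = a, false = b).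
-- Flipping a segment interchanges the two tags; the point is that any choice of flips is realised
-- by a cycle of the same length (reversing an a–b arc, or moving a one-pole cycle to the other pole).
Segment : ℕ → Set
Segment v = (Fin v × Bool) × (Fin v × Bool)

flipSegment : ∀ {v} → Segment v → Segment v
flipSegment ((x1 , l1) , (x2 , l2)) = ((x1 , not l1) , (x2 , not l2))

data Flips {v} : List (Segment v) → List (Segment v) → Set where
  []ᶠ : Flips [] []
  keep : ∀ {s S S'} → Flips S S' → Flips (s ∷ S) (s ∷ S')
  flip : ∀ {s S S'} → Flips S S' → Flips (s ∷ S) (flipSegment s ∷ S')

Flips-refl : ∀ {v} (S : List (Segment v)) → Flips S S
Flips-refl [] = []ᶠ
Flips-refl (s ∷ S) = keep (Flips-refl S)

Flips-++⁻ : ∀ {v} (S1 : List (Segment v)) {S2 S'} → Flips (S1 ++ S2) S' →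
  Σ (List (Segment v)) λ S1' → Σ (List (Segment v)) λ S2' → Flips S1 S1' × Flips S2 S2' × S' ≡ S1' ++ S2'
Flips-++⁻ [] f = [] , _ , []ᶠ , f , refl
Flips-++⁻ (s ∷ S1) (keep f) with Flips-++⁻ S1 f
... | S1' , S2' , f1 , f2 , refl = s ∷ S1' , S2' , keep f1 , f2 , refl
Flips-++⁻ (s ∷ S1) (flip f) with Flips-++⁻ S1 f
... | S1' , S2' , f1 , f2 , refl = flipSegment s ∷ S1' , S2' , flip f1 , f2 , refl

Flips-++ : ∀ {v} {S1 S2 S1' S2' : List (Segment v)} → Flips S1 S1' → Flips S2 S2' → Flips (S1 ++ S2) (S1' ++ S2')
Flips-++ []ᶠ f2 = f2
Flips-++ (keep f1) f2 = keep (Flips-++ f1 f2)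
Flips-++ (flip f1) f2 = flip (Flips-++ f1 f2)

concatFin : ∀ {A : Set} {t} → (Fin t → List A) → List A
concatFin {t = zero} f = []
concatFin {t = suc t} f = f zero ++ concatFin (λ i → f (suc i))

Flips-concatFin⁻ : ∀ {v t} (f : Fin t → List (Segment v)) {S'} → Flips (concatFin f) S' →
  Σ (Fin t → List (Segment v)) λ g → (∀ i → Flips (f i) (g i)) × S' ≡ concatFin g
Flips-concatFin⁻ {v} {t = zero} f []ᶠ = (λ ()) , (λ ()) , refl
Flips-concatFin⁻ {t = suc t} f fl with Flips-++⁻ (f zero) fl
... | S1' , S2' , f1 , f2 , refl with Flips-concatFin⁻ (λ i → f (suc i)) f2
... | g , fg , refl = g' , fg' , refl
  where
  g' : Fin (suc t) → List (Segment _)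
  g' zero = S1'
  g' (suc i) = g i
  fg' : ∀ i → Flips (f i) (g' i)
  fg' zero = f1
  fg' (suc i) = fg i

pathG-∷ʳ : ∀ {v} (h : Fin v) xs t → pathG (h ∷ xs ++ [ t ]) ≈ pathG (h ∷ xs) ⊕ edge (lastOf h xs) t
pathG-∷ʳ h [] t p q = +-comm (edge h t p q) 0
pathG-∷ʳ h (x ∷ xs) t p q rewrite pathG-∷ʳ x xs t p q = sym (+-assoc (edge h x p q) _ _)

module Segments {v : ℕ} (a b : Fin v) (a≢b : a ≢ b) where

  open import Data.List.Membership.DecPropositional (_≟_ {v}) using (_∈?_)

  pole : Bool → Fin v
  pole true = a
  pole false = b

  pole-injective : ∀ {ℓ k} → pole ℓ ≡ pole k → ℓ ≡ k
  pole-injective {true} {true} e = refl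
  pole-injective {true} {false} e = ⊥-elim (a≢b e)
  pole-injective {false} {true} e = ⊥-elim (a≢b (sym e))
  pole-injective {false} {false} e = refl

  Away : Fin v → Set
  Away x = x ≢ a × x ≢ b

  pole≢away : ∀ {x} ℓ → Away x → pole ℓ ≢ x
  pole≢away true (xa , xb) e = xa (sym e)
  pole≢away false (xa , xb) e = xb (sym e)

  AvoidsPoles : List (Fin v) → Set
  AvoidsPoles P = a ∉ P × b ∉ P

  pole-∉ : ∀ ℓ {P} → AvoidsPoles P → pole ℓ ∉ P
  pole-∉ true = proj₁
  pole-∉ false = proj₂

  attachG : List (Segment v) → Graph v
  attachG [] = ∅G
  attachG (((x1 , l1) , (x2 , l2)) ∷ S) = edge (pole l1) x1 ⊕ edge (pole l2) x2 ⊕ attachG S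

  attachG-++ : ∀ S1 S2 → attachG (S1 ++ S2) ≈ attachG S1 ⊕ attachG S2
  attachG-++ [] S2 p q = refl
  attachG-++ (((x1 , l1) , (x2 , l2)) ∷ S1) S2 p q rewrite attachG-++ S1 S2 p q =
    sym (+-assoc (edge (pole l1) x1 p q + edge (pole l2) x2 p q) _ _)

  AllAway : List (Segment v) → Set
  AllAway [] = ⊤
  AllAway (((x1 , _) , (x2 , _)) ∷ S) = Away x1 × Away x2 × AllAway S

  AllAway-++ : ∀ S1 S2 → AllAway S1 → AllAway S2 → AllAway (S1 ++ S2)
  AllAway-++ [] S2 _ h = h
  AllAway-++ (_ ∷ S1) S2 (h1 , h2 , h) h' = h1 , h2 , AllAway-++ S1 S2 h h'

  attachG-concatFin : ∀ {t} (f : Fin t → List (Segment v)) p q → attachG (concatFin f) p q ≡ sumFin (λ i → attachG (f i) p q)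
  attachG-concatFin {zero} f p q = refl
  attachG-concatFin {suc t} f p q =
    trans (attachG-++ (f zero) _ p q) (cong (attachG (f zero) p q +_) (attachG-concatFin (λ i → f (suc i)) p q))

  AllAway-concatFin : ∀ {t} (f : Fin t → List (Segment v)) → (∀ i → AllAway (f i)) → AllAway (concatFin f)
  AllAway-concatFin {zero} f h = _
  AllAway-concatFin {suc t} f h = AllAway-++ (f zero) _ (h zero) (AllAway-concatFin (λ i → f (suc i)) (λ i → h (suc i)))

  NoPoleEdges : Graph v → Set
  NoPoleEdges R = ∀ k x → Away x → R (pole k) x ≡ 0

  arcG : Fin v → List (Fin v) → Fin v → Graph v
  arcG u P t = pathG (u ∷ P ++ [ t ])

  segmentsOf : Bool → List (Fin v) → Bool → List (Segment v)
  segmentsOf ℓ1 [] ℓ2 = []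
  segmentsOf ℓ1 (h ∷ P) ℓ2 = ((h , ℓ1) , (lastOf h P , ℓ2)) ∷ []

  interiorG : Bool → List (Fin v) → Bool → Graph v
  interiorG ℓ1 [] ℓ2 = edge (pole ℓ1) (pole ℓ2)
  interiorG ℓ1 (h ∷ P) ℓ2 = pathG (h ∷ P)

  arcG-split : ∀ ℓ1 ℓ2 P → arcG (pole ℓ1) P (pole ℓ2) ≈ interiorG ℓ1 P ℓ2 ⊕ attachG (segmentsOf ℓ1 P ℓ2)
  arcG-split ℓ1 ℓ2 [] p q = refl
  arcG-split ℓ1 ℓ2 (h ∷ P) p q rewrite pathG-∷ʳ h P (pole ℓ2) p q | edge-comm (lastOf h P) (pole ℓ2) p q =
    rearrange (edge (pole ℓ1) h p q) (pathG (h ∷ P) p q) (edge (pole ℓ2) (lastOf h P) p q)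
    where
    rearrange : ∀ x y z → x + (y + z) ≡ y + (x + z + 0)
    rearrange = solve-∀

  arcG-reverse : ∀ u P t → arcG u (reverse P) t ≈ arcG t P u
  arcG-reverse u P t p q = trans (cong (λ l → pathG l p q) (sym reverse-arc)) (pathG-reverse (t ∷ P ++ [ u ]) p q)
    where
    reverse-arc : reverse (t ∷ P ++ [ u ]) ≡ u ∷ reverse P ++ [ t ]
    reverse-arc = trans (unfold-reverse t (P ++ [ u ])) (cong (_++ [ t ]) (reverse-++ P [ u ]))

  segmentsOf-away : ∀ ℓ1 P ℓ2 → AvoidsPoles P → AllAway (segmentsOf ℓ1 P ℓ2)
  segmentsOf-away ℓ1 [] ℓ2 _ = _
  segmentsOf-away ℓ1 (h ∷ P) ℓ2 (na , nb) = away (here refl) , away (lastOf-∈ h P) , _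
    where
    away : ∀ {x} → x ∈ h ∷ P → Away x
    away m = (λ e → na (subst (_∈ h ∷ P) e m)) , (λ e → nb (subst (_∈ h ∷ P) e m))

  interiorG-noPoleEdges : ∀ ℓ1 P ℓ2 → AvoidsPoles P → NoPoleEdges (interiorG ℓ1 P ℓ2)
  interiorG-noPoleEdges ℓ1 [] ℓ2 _ k x hx = edge-≡0 (inj₂ (pole≢away ℓ2 hx)) (inj₁ (pole≢away ℓ1 hx))
  interiorG-noPoleEdges ℓ1 (h ∷ P) ℓ2 av k x hx = pathG-∉ˡ (h ∷ P) (pole-∉ k av) x

  record Realization (l : List (Fin v)) (R : Graph v) (S' : List (Segment v)) : Set where
    constructor realization
    field
      cycle : List (Fin v)
      distinct : Distinct cycle
      length-≡ : length cycle ≡ length l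
      split : cycleG cycle ≈ R ⊕ attachG S'

  record Decomposition (l : List (Fin v)) : Set where
    constructor decomposition
    field
      segments : List (Segment v)
      rest : Graph v
      segments-away : AllAway segments
      rest-noPoleEdges : NoPoleEdges rest
      split : cycleG l ≈ rest ⊕ attachG segments
      realize : ∀ S' → Flips segments S' → Realization l rest S'

  Decomposition-↭ : ∀ {l l0} → l ↭ l0 → cycleG l ≈ cycleG l0 → Decomposition l0 → Decomposition l
  Decomposition-↭ p e (decomposition S R ax rz eq fl) =
    decomposition S R ax rz (λ x y → trans (e x y) (eq x y))
      λ S' f → let realization l' d' len' eq' = fl S' f in realization l' d' (trans len' (sym (↭-length p))) eq'

  decompose-one : ∀ ℓ r → AvoidsPoles r → Distinct r → Decomposition (pole ℓ ∷ r)
  decompose-one ℓ r av d =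
    decomposition (segmentsOf ℓ r ℓ) (interiorG ℓ r ℓ) (segmentsOf-away ℓ r ℓ av) (interiorG-noPoleEdges ℓ r ℓ av)
      (arcG-split ℓ ℓ r) (realize r av d)
    where
    realize : ∀ r → AvoidsPoles r → Distinct r → ∀ S' → Flips (segmentsOf ℓ r ℓ) S' → Realization (pole ℓ ∷ r) (interiorG ℓ r ℓ) S'
    realize [] av d .[] []ᶠ = realization (pole ℓ ∷ []) ((λ ()) ∷ᵈ []ᵈ) refl (arcG-split ℓ ℓ [])
    realize (h ∷ Q) av d _ (keep []ᶠ) = realization (pole ℓ ∷ h ∷ Q) (pole-∉ ℓ av ∷ᵈ d) refl (arcG-split ℓ ℓ (h ∷ Q))
    realize (h ∷ Q) av d _ (flip []ᶠ) =
      realization (pole (not ℓ) ∷ h ∷ Q) (pole-∉ (not ℓ) av ∷ᵈ d) refl (arcG-split (not ℓ) (not ℓ) (h ∷ Q))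

  arcG-flip : ∀ ℓ P → ∀ S' → Flips (segmentsOf ℓ P (not ℓ)) S' →
    Σ (List (Fin v)) λ P' → P' ↭ P × arcG (pole ℓ) P' (pole (not ℓ)) ≈ interiorG ℓ P (not ℓ) ⊕ attachG S'
  arcG-flip ℓ [] .[] []ᶠ = [] , ↭-refl , arcG-split ℓ (not ℓ) []
  arcG-flip ℓ (h ∷ Q) _ (keep []ᶠ) = h ∷ Q , ↭-refl , arcG-split ℓ (not ℓ) (h ∷ Q)
  arcG-flip true (h ∷ Q) _ (flip []ᶠ) = reverse (h ∷ Q) , ↭-reverse (h ∷ Q) ,
    λ p q → trans (arcG-reverse a (h ∷ Q) b p q) (arcG-split false true (h ∷ Q) p q)
  arcG-flip false (h ∷ Q) _ (flip []ᶠ) = reverse (h ∷ Q) , ↭-reverse (h ∷ Q) ,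
    λ p q → trans (arcG-reverse b (h ∷ Q) a p q) (arcG-split true false (h ∷ Q) p q)

  cycleG-both : ∀ P1 P2 → cycleG (a ∷ P1 ++ b ∷ P2) ≈ arcG a P1 b ⊕ arcG b P2 a
  cycleG-both P1 P2 p q = trans (cong (λ l → pathG l p q) (cong (a ∷_) (++-assoc P1 (b ∷ P2) [ a ])))
                               (pathG-++ (a ∷ P1) b (P2 ++ [ a ]) p q)

  cycleG-both-split : ∀ P1 P2 {R1 R2} S1 S2 → arcG a P1 b ≈ R1 ⊕ attachG S1 → arcG b P2 a ≈ R2 ⊕ attachG S2 →
    cycleG (a ∷ P1 ++ b ∷ P2) ≈ (R1 ⊕ R2) ⊕ attachG (S1 ++ S2)
  cycleG-both-split P1 P2 {R1} {R2} S1 S2 e1 e2 p q = begin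
    cycleG (a ∷ P1 ++ b ∷ P2) p q
      ≡⟨ cycleG-both P1 P2 p q ⟩
    arcG a P1 b p q + arcG b P2 a p q
      ≡⟨ cong₂ _+_ (e1 p q) (e2 p q) ⟩
    (R1 p q + attachG S1 p q) + (R2 p q + attachG S2 p q)
      ≡⟨ interchange (R1 p q) (attachG S1 p q) (R2 p q) (attachG S2 p q) ⟩
    (R1 p q + R2 p q) + (attachG S1 p q + attachG S2 p q)
      ≡⟨ cong (R1 p q + R2 p q +_) (sym (attachG-++ S1 S2 p q)) ⟩
    (R1 p q + R2 p q) + attachG (S1 ++ S2) p q ∎
    where
    open ≡-Reasoning
    interchange : ∀ x y z w → x + y + (z + w) ≡ x + z + (y + w)
    interchange = solve-∀

  decompose-both : ∀ P1 P2 → Distinct (a ∷ P1 ++ b ∷ P2) → Decomposition (a ∷ P1 ++ b ∷ P2)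
  decompose-both P1 P2 d =
    decomposition (S1 ++ S2) (interiorG true P1 false ⊕ interiorG false P2 true)
      (AllAway-++ S1 S2 (segmentsOf-away true P1 false av1) (segmentsOf-away false P2 true av2))
      (λ k x hx → cong₂ _+_ (interiorG-noPoleEdges true P1 false av1 k x hx) (interiorG-noPoleEdges false P2 true av2 k x hx))
      (cycleG-both-split P1 P2 S1 S2 (arcG-split true false P1) (arcG-split false true P2))
      realize
    where
    S1 : List (Segment v)
    S1 = segmentsOf true P1 false
    S2 : List (Segment v)
    S2 = segmentsOf false P2 true
    a∉ : a ∉ P1 ++ b ∷ P2
    a∉ = Distinct-head d
    b∉ : b ∉ P1 × b ∉ P2
    b∉ = Distinct-middle P1 (Distinct-tail d)
    av1 : AvoidsPoles P1
    av1 = (λ m → a∉ (∈-++⁺ˡ m)) , proj₁ b∉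
    av2 : AvoidsPoles P2
    av2 = (λ m → a∉ (∈-++⁺ʳ P1 (there m))) , proj₂ b∉
    realize : ∀ S' → Flips (S1 ++ S2) S' → Realization (a ∷ P1 ++ b ∷ P2) (interiorG true P1 false ⊕ interiorG false P2 true) S'
    realize S' f with Flips-++⁻ S1 f
    ... | S1' , S2' , f1 , f2 , refl with arcG-flip true P1 S1' f1 | arcG-flip false P2 S2' f2
    ... | P1' , p1 , e1 | P2' , p2 , e2 =
      realization (a ∷ P1' ++ b ∷ P2') (Distinct-↭ (↭-sym perm) d) (↭-length perm) (cycleG-both-split P1' P2' S1' S2' e1 e2)
      where
      perm : a ∷ P1' ++ b ∷ P2' ↭ a ∷ P1 ++ b ∷ P2
      perm = P.prep a (P.trans (++⁺ʳ (b ∷ P2') p1) (++⁺ˡ P1 (P.prep b p2)))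

  decompose-a : ∀ r → Distinct (a ∷ r) → Decomposition (a ∷ r)
  decompose-a r d with b ∈? r
  ... | yes m with ∈-∃++ m
  ...   | P1 , P2 , refl = decompose-both P1 P2 d
  decompose-a r d | no nb = decompose-one true r (Distinct-head d , nb) (Distinct-tail d)

  decompose : ∀ l → Distinct l → Decomposition l
  decompose l d with a ∈? l
  ... | yes m with ∈-∃++ m
  ...   | ys , zs , refl = Decomposition-↭ perm (cycleG-rotate ys (a ∷ zs)) (decompose-a (zs ++ ys) (Distinct-↭ perm d))
    where
    perm : ys ++ a ∷ zs ↭ a ∷ zs ++ ys
    perm = ++-comm ys (a ∷ zs)
  decompose l d | no na with b ∈? l
  ... | yes m with ∈-∃++ m
  ...   | ys , zs , refl = Decomposition-↭ perm (cycleG-rotate ys (b ∷ zs))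
           (decompose-one false (zs ++ ys) ((λ m → na (∈-resp-↭ (↭-sym perm) (there m))) , Distinct-head d') (Distinct-tail d'))
    where
    perm : ys ++ b ∷ zs ↭ b ∷ zs ++ ys
    perm = ++-comm ys (b ∷ zs)
    d' : Distinct (b ∷ zs ++ ys)
    d' = Distinct-↭ perm d
  decompose l d | no na | no nb =
    decomposition [] (cycleG l) _ (λ { true x hx → cycleG-∉ˡ l na x ; false x hx → cycleG-∉ˡ l nb x })
      (λ p q → sym (+-identityʳ _))
      λ { .[] []ᶠ → realization l d refl λ p q → sym (+-identityʳ _) }

-- Alternating trails and the switching lemma

module Trail {v : ℕ} (a b : Fin v) (a≢b : a ≢ b) where
  open Segments a b a≢b

  edge-≡0-apart : ∀ {x y} ℓ k → Away y → x ≢ y → edge (pole ℓ) x (pole k) y ≡ 0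
  edge-≡0-apart ℓ k hy ne = edge-≡0 (inj₂ ne) (inj₁ (pole≢away ℓ hy))

  edge-≡0-poles : ∀ {x y} ℓ k → Away y → ℓ ≢ k → edge (pole ℓ) x (pole k) y ≡ 0
  edge-≡0-poles ℓ k hy ne = edge-≡0 (inj₁ (λ e → ne (pole-injective e))) (inj₁ (pole≢away ℓ hy))

  edge-pole-≡1 : ∀ {x} ℓ → Away x → edge (pole ℓ) x (pole ℓ) x ≡ 1
  edge-pole-≡1 ℓ hx = edge-≡1 (pole≢away ℓ hx)

  AllAway-middle : ∀ S1 s S2 → AllAway (S1 ++ s ∷ S2) → AllAway (S1 ++ S2)
  AllAway-middle [] _ S2 (_ , _ , h) = h
  AllAway-middle (_ ∷ S1) s S2 (h1 , h2 , h) = h1 , h2 , AllAway-middle S1 s S2 h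

  attachG-middle : ∀ S1 s S2 → attachG (S1 ++ s ∷ S2) ≈ attachG (S1 ++ S2) ⊕ attachG (s ∷ [])
  attachG-middle S1 s S2 p q = begin
    attachG (S1 ++ s ∷ S2) p q
      ≡⟨ attachG-++ S1 (s ∷ S2) p q ⟩
    attachG S1 p q + attachG (s ∷ S2) p q
      ≡⟨ cong (attachG S1 p q +_) (trans (attachG-++ (s ∷ []) S2 p q) (+-comm (attachG (s ∷ []) p q) _)) ⟩
    attachG S1 p q + (attachG S2 p q + attachG (s ∷ []) p q)
      ≡⟨ sym (+-assoc (attachG S1 p q) _ _) ⟩
    attachG S1 p q + attachG S2 p q + attachG (s ∷ []) p q
      ≡⟨ cong (_+ attachG (s ∷ []) p q) (sym (attachG-++ S1 S2 p q)) ⟩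
    attachG (S1 ++ S2) p q + attachG (s ∷ []) p q ∎
    where open ≡-Reasoning

  Anchored : Segment v → Fin v → Bool → Fin v → Bool → Set
  Anchored s w ℓ z m = (attachG (s ∷ []) ≈ edge (pole ℓ) w ⊕ edge (pole m) z) ×
                       (attachG (flipSegment s ∷ []) ≈ edge (pole (not ℓ)) w ⊕ edge (pole (not m)) z)

  AnchorSplit : List (Segment v) → Fin v → Bool → Set
  AnchorSplit Ss w ℓ = Σ (List (Segment v)) λ S1 → Σ (List (Segment v)) λ S2 → Σ (Segment v) λ s → Σ (Fin v) λ z → Σ Bool λ m →
    (Ss ≡ S1 ++ s ∷ S2) × Away z × Anchored s w ℓ z m

  findAnchor : ∀ Ss w ℓ → AllAway Ss → Away w → 0 < attachG Ss (pole ℓ) w → AnchorSplit Ss w ℓ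
  findAnchor [] w ℓ ax hw ()
  findAnchor (s@((x1 , l1) , (x2 , l2)) ∷ S) w ℓ (h1 , h2 , ax) hw pos
    with edge-view (pole l1) x1 (pole ℓ) w | edge-view (pole l2) x2 (pole ℓ) w
  ... | inj₂ (inj₁ (e1 , refl)) | _ with pole-injective e1
  ...   | refl = [] , S , s , x2 , l2 , refl , h2 , (λ p q → +-identityʳ _) , (λ p q → +-identityʳ _)
  findAnchor (((x1 , l1) , (x2 , l2)) ∷ S) w ℓ (h1 , h2 , ax) hw pos | inj₂ (inj₂ (e1 , _)) | _ = ⊥-elim (pole≢away l1 hw e1)
  findAnchor (s@((x1 , l1) , (x2 , l2)) ∷ S) w ℓ (h1 , h2 , ax) hw pos | inj₁ _ | inj₂ (inj₁ (e2 , refl)) with pole-injective e2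
  ...   | refl = [] , S , s , x1 , l1 , refl , h1 ,
                 (λ p q → trans (+-identityʳ _) (+-comm (edge (pole l1) x1 p q) _)) ,
                 (λ p q → trans (+-identityʳ _) (+-comm (edge (pole (not l1)) x1 p q) _))
  findAnchor (((x1 , l1) , (x2 , l2)) ∷ S) w ℓ (h1 , h2 , ax) hw pos | inj₁ _ | inj₂ (inj₂ (e2 , _)) = ⊥-elim (pole≢away l2 hw e2)
  findAnchor (s ∷ S) w ℓ (h1 , h2 , ax) hw pos | inj₁ z1 | inj₁ z2
    with findAnchor S w ℓ ax hw (subst (0 <_) (cong₂ (λ u t → u + t + attachG S (pole ℓ) w) z1 z2) pos)
  ... | S1 , S2 , s' , z , m , refl , hz , an = s ∷ S1 , S2 , s' , z , m , refl , hz , an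

  withSegment : Graph v → Fin v → Bool → Fin v → Bool → Graph v
  withSegment G w ℓ z m p q = G p q + edge (pole ℓ) w p q + edge (pole m) z p q

  stuck-apart : ∀ gm gn x1 x2 x3 y1 y2 → x1 ≡ 0 → x2 ≡ 0 → x3 ≡ 0 → y1 ≡ 0 → y2 ≡ 1 →
    ¬ (gn + x1 + x2 + x3 + 1 ≤ gm + y1 + y2) → gm < gn
  stuck-apart gm gn _ _ _ _ _ refl refl refl refl refl stuck =
    ≤-pred {1 + gm} {gn} (subst₂ _≤_ (normalise₁ gm) (normalise₂ gn) (≰⇒> stuck))
    where
    normalise₁ : ∀ t → 1 + (t + 0 + 1) ≡ 2 + t
    normalise₁ = solve-∀
    normalise₂ : ∀ t → t + 0 + 0 + 0 + 1 ≡ 1 + t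
    normalise₂ = solve-∀

  stuck-same-pole : ∀ gm gn x1 x2 x3 y1 y2 → x1 ≡ 0 → x2 ≡ 0 → x3 ≡ 1 → y1 ≡ 1 → y2 ≡ 1 →
    ¬ (gn + x1 + x2 + x3 + 1 ≤ gm + y1 + y2) → gm < gn
  stuck-same-pole gm gn _ _ _ _ _ refl refl refl refl refl stuck =
    ≤-pred {1 + gm} {gn} (≤-pred {2 + gm} {1 + gn} (subst₂ _≤_ (normalise₁ gm) (normalise₂ gn) (≰⇒> stuck)))
    where
    normalise₁ : ∀ t → 1 + (t + 1 + 1) ≡ 3 + t
    normalise₁ = solve-∀
    normalise₂ : ∀ t → t + 0 + 0 + 1 + 1 ≡ 2 + t
    normalise₂ = solve-∀

  stuck-other-pole : ∀ g1 g2 x1 x2 y1 y2 → x1 ≡ 0 → x2 ≡ 1 → y1 ≡ 1 → y2 ≡ 0 → g1 + x1 + x2 < g2 + y1 + y2 → g1 < g2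
  stuck-other-pole g1 g2 _ _ _ _ refl refl refl refl h = ≤-pred {1 + g1} {g2} (subst₂ _≤_ (normalise₁ g1) (normalise₂ g2) h)
    where
    normalise₁ : ∀ t → 1 + (t + 0 + 1) ≡ 2 + t
    normalise₁ = solve-∀
    normalise₂ : ∀ t → t + 1 + 0 ≡ 1 + t
    normalise₂ = solve-∀

  continue-trail : ∀ (G : Graph v) w ℓ z m → Away w → Away z → Dec (z ≡ w) → Dec (ℓ ≡ m) →
    withSegment G w ℓ z m (pole (not ℓ)) w < withSegment G w ℓ z m (pole ℓ) w →
    ¬ (withSegment G w ℓ z m (pole (not m)) z + edge (pole (not ℓ)) w (pole (not m)) z + 1 ≤ withSegment G w ℓ z m (pole m) z) →
    G (pole m) z < G (pole (not m)) z
  continue-trail G w ℓ z m hw hz (no z≢w) _ more-at-ℓ stuck =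
    stuck-apart _ _ _ _ _ _ _ (edge-≡0-apart ℓ (not m) hz w≢z) (edge-≡0-poles m (not m) hz (≢not m))
                   (edge-≡0-apart (not ℓ) (not m) hz w≢z) (edge-≡0-apart ℓ m hz w≢z) (edge-pole-≡1 m hz) stuck
    where
    w≢z : w ≢ z
    w≢z e = z≢w (sym e)
  continue-trail G w ℓ .w .ℓ hw hz (yes refl) (yes refl) more-at-ℓ stuck =
    stuck-same-pole _ _ _ _ _ _ _ (edge-≡0-poles ℓ (not ℓ) hw (≢not ℓ)) (edge-≡0-poles ℓ (not ℓ) hw (≢not ℓ))
                   (edge-pole-≡1 (not ℓ) hw) (edge-pole-≡1 ℓ hw) (edge-pole-≡1 ℓ hw) stuck
  continue-trail G w true .w false hw hz (yes refl) (no _) more-at-ℓ stuck =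
    stuck-other-pole _ _ _ _ _ _ (edge-≡0-poles true false hw (λ ())) (edge-pole-≡1 false hw) (edge-pole-≡1 true hw)
                     (edge-≡0-poles false true hw (λ ())) more-at-ℓ
  continue-trail G w false .w true hw hz (yes refl) (no _) more-at-ℓ stuck =
    stuck-other-pole _ _ _ _ _ _ (edge-≡0-poles false true hw (λ ())) (edge-pole-≡1 true hw) (edge-pole-≡1 false hw)
                     (edge-≡0-poles true false hw (λ ())) more-at-ℓ
  continue-trail G w true .w true hw hz (yes refl) (no n) more-at-ℓ stuck = ⊥-elim (n refl)
  continue-trail G w false .w false hw hz (yes refl) (no n) more-at-ℓ stuck = ⊥-elim (n refl)

  feasible-apart : ∀ g1 g2 e x1 x2 x3 c → x1 ≡ 0 → x2 ≡ 0 → x3 ≡ 0 → g1 + e + 1 ≤ g2 → g1 + x1 + e + x2 + 1 ≤ g2 + x3 + c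
  feasible-apart g1 g2 e _ _ _ c refl refl refl h =
    subst (_≤ g2 + 0 + c) (sym (normalise g1 e)) (≤-trans h (≤-trans (m≤m+n g2 0) (m≤m+n (g2 + 0) c)))
    where
    normalise : ∀ g e → g + 0 + e + 0 + 1 ≡ g + e + 1
    normalise = solve-∀

  feasible-same-pole : ∀ g1 g2 e x1 x2 x3 c → x1 ≡ 0 → x2 ≡ 1 → x3 ≡ 1 → g1 + e + 1 ≤ g2 → g1 + x1 + e + x2 + 1 ≤ g2 + x3 + c
  feasible-same-pole g1 g2 e _ _ _ c refl refl refl h =
    subst (_≤ g2 + 1 + c) (sym (normalise g1 e)) (≤-trans (+-monoˡ-≤ 1 h) (m≤m+n (g2 + 1) c))
    where
    normalise : ∀ g e → g + 0 + e + 1 + 1 ≡ g + e + 1 + 1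
    normalise = solve-∀

  infeasible-other-pole : ∀ g1 g2 e1 e2 x1 x2 → x1 ≡ 0 → x2 ≡ 1 → g1 + e1 + 1 ≤ g2 → g2 + x1 + e2 < g1 + x2 + e1 → ⊥
  infeasible-other-pole g1 g2 e1 e2 _ _ refl refl h1 h2 =
    <-irrefl refl (<-≤-trans h2 (subst (_≤ g2 + 0 + e2) (sym (normalise g1 e1))
      (≤-trans h1 (≤-trans (m≤m+n g2 0) (m≤m+n (g2 + 0) e2)))))
    where
    normalise : ∀ g e → g + 1 + e ≡ g + e + 1
    normalise = solve-∀

  extend-feasible : ∀ (G : Graph v) w ℓ z m y ℓ' → Away w → Away z → Away y → Dec (y ≡ w) → Dec (ℓ' ≡ ℓ) →
    withSegment G w ℓ z m (pole (not ℓ)) w < withSegment G w ℓ z m (pole ℓ) w →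
    G (pole (not ℓ')) y + edge (pole m) z (pole (not ℓ')) y + 1 ≤ G (pole ℓ') y →
    withSegment G w ℓ z m (pole (not ℓ')) y + edge (pole (not ℓ)) w (pole (not ℓ')) y + 1 ≤ withSegment G w ℓ z m (pole ℓ') y
  extend-feasible G w ℓ z m y ℓ' hw hz hy (no y≢w) _ more-at-ℓ feasible =
    feasible-apart (G (pole (not ℓ')) y) (G (pole ℓ') y) (edge (pole m) z (pole (not ℓ')) y) (edge (pole ℓ) w (pole (not ℓ')) y)
      (edge (pole (not ℓ)) w (pole (not ℓ')) y) (edge (pole ℓ) w (pole ℓ') y) (edge (pole m) z (pole ℓ') y)
      (edge-≡0-apart ℓ (not ℓ') hy w≢y) (edge-≡0-apart (not ℓ) (not ℓ') hy w≢y) (edge-≡0-apart ℓ ℓ' hy w≢y) feasible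
    where
    w≢y : w ≢ y
    w≢y e = y≢w (sym e)
  extend-feasible G w ℓ z m .w .ℓ hw hz hy (yes refl) (yes refl) more-at-ℓ feasible =
    feasible-same-pole (G (pole (not ℓ)) w) (G (pole ℓ) w) (edge (pole m) z (pole (not ℓ)) w) (edge (pole ℓ) w (pole (not ℓ)) w)
      (edge (pole (not ℓ)) w (pole (not ℓ)) w) (edge (pole ℓ) w (pole ℓ) w) (edge (pole m) z (pole ℓ) w)
      (edge-≡0-poles ℓ (not ℓ) hw (≢not ℓ)) (edge-pole-≡1 (not ℓ) hw) (edge-pole-≡1 ℓ hw) feasible
  extend-feasible G w true z m .w false hw hz hy (yes refl) (no _) more-at-ℓ feasible =
    ⊥-elim (infeasible-other-pole (G a w) (G b w) (edge (pole m) z a w) (edge (pole m) z b w) (edge a w b w) (edge a w a w)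
              (edge-≡0-poles true false hw (λ ())) (edge-pole-≡1 true hw) feasible more-at-ℓ)
  extend-feasible G w false z m .w true hw hz hy (yes refl) (no _) more-at-ℓ feasible =
    ⊥-elim (infeasible-other-pole (G b w) (G a w) (edge (pole m) z b w) (edge (pole m) z a w) (edge b w a w) (edge b w b w)
              (edge-≡0-poles false true hw (λ ())) (edge-pole-≡1 false hw) feasible more-at-ℓ)
  extend-feasible G w true z m .w true hw hz hy (yes refl) (no n) more-at-ℓ feasible = ⊥-elim (n refl)
  extend-feasible G w false z m .w false hw hz hy (yes refl) (no n) more-at-ℓ feasible = ⊥-elim (n refl)

  TrailOutcome : List (Segment v) → Fin v → Bool → Set
  TrailOutcome Ss w ℓ = Σ (List (Segment v)) λ Ss' → Σ (Fin v) λ y → Σ Bool λ ℓ' →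
    Flips Ss Ss' × Away y ×
    (∀ p q → attachG Ss' p q + edge (pole ℓ) w p q + edge (pole ℓ') y p q ≡
             attachG Ss p q + edge (pole (not ℓ)) w p q + edge (pole (not ℓ')) y p q) ×
    (attachG Ss (pole (not ℓ')) y + edge (pole (not ℓ)) w (pole (not ℓ')) y + 1 ≤ attachG Ss (pole ℓ') y)

  stop-exchange : ∀ (g a b c d : ℕ) → g + (a + b) + c + d ≡ g + c + d + a + b
  stop-exchange = solve-∀

  continue-exchange : ∀ g' g a b c d e f → g' + c + d ≡ g + e + f → g' + (a + c) + b + d ≡ g + b + e + a + f
  continue-exchange g' g a b c d e f h = trans (regroup₁ g' a b c d) (trans (cong (_+ (a + b)) h) (regroup₂ g b e a f))
    where
    regroup₁ : ∀ (g' a b c d : ℕ) → g' + (a + c) + b + d ≡ (g' + c + d) + (a + b)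
    regroup₁ = solve-∀
    regroup₂ : ∀ (g b e a f : ℕ) → (g + e + f) + (a + b) ≡ g + b + e + a + f
    regroup₂ = solve-∀

  -- Flip a segment with an ℓ-end at w. If its other end z can take the flip, stop; otherwise z has more
  -- ends at pole (not m) than at m among the remaining segments, and the trail continues from z.
  -- Every segment is flipped at most once, which bounds the recursion by the number of segments.
  alternatingTrail : ∀ n Ss → length Ss ≡ n → AllAway Ss → ∀ w ℓ → Away w →
    attachG Ss (pole (not ℓ)) w < attachG Ss (pole ℓ) w → TrailOutcome Ss w ℓ
  alternatingTrail zero [] _ ax w ℓ hw ()
  alternatingTrail (suc n) Ss len ax w ℓ hw more-at-ℓ with findAnchor Ss w ℓ ax hw (≤-trans (s≤s z≤n) more-at-ℓ)
  ... | S1 , S2 , s , z , m , refl , hz , (attach-s , attach-flipped) = step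
    where
    G : Graph v
    G = attachG (S1 ++ S2)
    split : ∀ p q → attachG (S1 ++ s ∷ S2) p q ≡ withSegment G w ℓ z m p q
    split p q = trans (attachG-middle S1 s S2 p q) (trans (cong (G p q +_) (attach-s p q)) (sym (+-assoc (G p q) _ _)))
    split-flipped : ∀ S1' S2' p q → attachG (S1' ++ flipSegment s ∷ S2') p q ≡
      attachG (S1' ++ S2') p q + (edge (pole (not ℓ)) w p q + edge (pole (not m)) z p q)
    split-flipped S1' S2' p q =
      trans (attachG-middle S1' (flipSegment s) S2' p q) (cong (attachG (S1' ++ S2') p q +_) (attach-flipped p q))
    more-at-ℓ′ : withSegment G w ℓ z m (pole (not ℓ)) w < withSegment G w ℓ z m (pole ℓ) w
    more-at-ℓ′ = subst₂ _<_ (split _ _) (split _ _) more-at-ℓ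
    step : TrailOutcome (S1 ++ s ∷ S2) w ℓ
    step with withSegment G w ℓ z m (pole (not m)) z + edge (pole (not ℓ)) w (pole (not m)) z + 1 ≤? withSegment G w ℓ z m (pole m) z
    ... | yes feasible = S1 ++ flipSegment s ∷ S2 , z , m , Flips-++ (Flips-refl S1) (flip (Flips-refl S2)) , hz ,
          (λ p q → trans (cong (λ t → t + edge (pole ℓ) w p q + edge (pole m) z p q) (split-flipped S1 S2 p q))
                    (trans (stop-exchange (G p q) (edge (pole (not ℓ)) w p q) (edge (pole (not m)) z p q) (edge (pole ℓ) w p q) (edge (pole m) z p q))
                      (cong (λ t → t + edge (pole (not ℓ)) w p q + edge (pole (not m)) z p q) (sym (split p q))))) ,
          subst₂ (λ t u → t + edge (pole (not ℓ)) w (pole (not m)) z + 1 ≤ u) (sym (split _ _)) (sym (split _ _)) feasible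
    ... | no stuck = extend (alternatingTrail n (S1 ++ S2) (length-remove S1 s S2 len) (AllAway-middle S1 s S2 ax) z (not m) hz more-at-not-m)
      where
      more-at-not-m : G (pole (not (not m))) z < G (pole (not m)) z
      more-at-not-m = subst (λ k → G (pole k) z < G (pole (not m)) z) (sym (not-involutive m))
                        (continue-trail G w ℓ z m hw hz (z ≟ w) (ℓ Bool.≟ m) more-at-ℓ′ stuck)
      extend : TrailOutcome (S1 ++ S2) z (not m) → TrailOutcome (S1 ++ s ∷ S2) w ℓ
      extend (Sr' , y , ℓ' , fr , hy , exchange , feasible) with Flips-++⁻ S1 fr
      ... | S1' , S2' , f1 , f2 , refl =
        S1' ++ flipSegment s ∷ S2' , y , ℓ' , Flips-++ f1 (flip f2) , hy ,
        (λ p q → trans (cong (λ t → t + edge (pole ℓ) w p q + edge (pole ℓ') y p q) (split-flipped S1' S2' p q))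
                 (trans (continue-exchange (attachG (S1' ++ S2') p q) (G p q) (edge (pole (not ℓ)) w p q) (edge (pole ℓ) w p q)
                                 (edge (pole (not m)) z p q) (edge (pole ℓ') y p q) (edge (pole m) z p q) (edge (pole (not ℓ')) y p q)
                                 (trans (exchange p q) (cong (λ k → G p q + edge (pole k) z p q + edge (pole (not ℓ')) y p q) (not-involutive m))))
                  (cong (λ t → t + edge (pole (not ℓ)) w p q + edge (pole (not ℓ')) y p q) (sym (split p q))))) ,
        subst₂ (λ t u → t + edge (pole (not ℓ)) w (pole (not ℓ')) y + 1 ≤ u) (sym (split _ _)) (sym (split _ _))
          (extend-feasible G w ℓ z m y ℓ' hw hz hy (y ≟ w) (ℓ' Bool.≟ ℓ) more-at-ℓ′
            (subst (λ k → G (pole (not ℓ')) y + edge (pole k) z (pole (not ℓ')) y + 1 ≤ G (pole ℓ') y) (not-involutive m) feasible))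

module Switching {v l : ℕ} {M : List ℕ} (P : Packing v l M) (a b : Fin v) (a≢b : a ≢ b) where
  open Segments a b a≢b
  open Trail a b a≢b
  open Packing P
  open Decomposition

  U : Graph v
  U = usedBy M cyc

  L : Graph v
  L = leave P

  K : Graph v
  K = complete v l

  cycleDecomposition : ∀ i → Decomposition (tabulate (cyc i))
  cycleDecomposition i = decompose (tabulate (cyc i)) (Distinct-tabulate (cyc i) (proj₂ (isCyc i)))

  segmentsAt : Fin (length M) → List (Segment v)
  segmentsAt i = segments (cycleDecomposition i)

  allSegments : List (Segment v)
  allSegments = concatFin segmentsAt

  restG : Graph v
  restG p q = sumFin (λ i → rest (cycleDecomposition i) p q)

  usedBy-split : (cyc' : (i : Fin (length M)) → Fin (lookup M i) → Fin v) (S : Fin (length M) → List (Segment v)) →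
    (∀ i → cycMult (cyc' i) ≈ rest (cycleDecomposition i) ⊕ attachG (S i)) →
    usedBy M cyc' ≈ restG ⊕ attachG (concatFin S)
  usedBy-split cyc' S h p q =
    trans (sumFin-cong (λ i → h i p q))
      (trans (sumFin-+ (λ i → rest (cycleDecomposition i) p q) (λ i → attachG (S i) p q))
        (cong (restG p q +_) (sym (attachG-concatFin S p q))))

  U-split : U ≈ restG ⊕ attachG allSegments
  U-split = usedBy-split cyc segmentsAt (λ i p q → trans (cycMult≈cycleG (cyc i) p q) (split (cycleDecomposition i) p q))

  U-at-pole : ∀ k x → Away x → U (pole k) x ≡ attachG allSegments (pole k) x
  U-at-pole k x hx = begin
    U (pole k) x                                               ≡⟨ U-split (pole k) x ⟩
    restG (pole k) x + attachG allSegments (pole k) x          ≡⟨ cong (_+ attachG allSegments (pole k) x) restG-at-pole ⟩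
    attachG allSegments (pole k) x                             ∎
    where
    open ≡-Reasoning
    restG-at-pole : restG (pole k) x ≡ 0
    restG-at-pole = trans (sumFin-cong (λ i → rest-noPoleEdges (cycleDecomposition i) k x hx)) (sumFin-0 {length M})

  U-at-pole≤λ : ∀ k x → Away x → U (pole k) x ≤ l
  U-at-pole≤λ k x hx = subst (U (pole k) x ≤_) (complete-≢ v l (pole k) x (pole≢away k hx)) (disjoint (pole k) x)

  L-at-pole : ∀ k x → Away x → L (pole k) x ≡ l ∸ U (pole k) x
  L-at-pole k x hx = cong (_∸ U (pole k) x) (complete-≢ v l (pole k) x (pole≢away k hx))

  reflip : (g : Fin (length M) → List (Segment v)) → (∀ i → Flips (segmentsAt i) (g i)) →
    Σ ((i : Fin (length M)) → Fin (lookup M i) → Fin v) λ cyc' →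
      (∀ i → IsCycle (cyc' i)) × (usedBy M cyc' ≈ restG ⊕ attachG (concatFin g))
  reflip g fg = cyc' , (λ i → proj₁ (isCyc i) , seqOf-injective (new i) (length-new i) (Realization.distinct (realized i))) ,
    usedBy-split cyc' g (λ i p q → trans (cycMult-seqOf (new i) (length-new i) p q) (Realization.split (realized i) p q))
    where
    realized : ∀ i → Realization (tabulate (cyc i)) (rest (cycleDecomposition i)) (g i)
    realized i = realize (cycleDecomposition i) (g i) (fg i)
    new : Fin (length M) → List (Fin v)
    new i = Realization.cycle (realized i)
    length-new : ∀ i → length (new i) ≡ lookup M i
    length-new i = trans (Realization.length-≡ (realized i)) (length-tabulate (cyc i))
    cyc' : (i : Fin (length M)) → Fin (lookup M i) → Fin v
    cyc' i = seqOf (new i) (length-new i)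

  -- The only pairs where the added edges can meet λ are (a, w), which has room since U a w < U b w ≤ λ,
  -- and (pole (not ℓ'), y), which has room by the feasibility of the last step of the trail.
  added-within-λ : ∀ w y ℓ' → Away w → Away y → U a w < U b w →
    attachG allSegments (pole (not ℓ')) y + edge a w (pole (not ℓ')) y + 1 ≤ attachG allSegments (pole ℓ') y →
    (U ⊕ (edge a w ⊕ edge (pole (not ℓ')) y)) ⊆ K
  added-within-λ w y ℓ' hw hy U<U feasible p q = by-cases p q (edge-view a w p q) (edge-view (pole (not ℓ')) y p q)
    where
    X : Graph v
    X = U ⊕ (edge a w ⊕ edge (pole (not ℓ')) y)
    symmetric : ∀ {p q} → X p q ≤ K p q → X q p ≤ K q p
    symmetric {p} {q} = subst₂ _≤_ (cong₂ _+_ (usedBy-sym M cyc p q) (cong₂ _+_ (edge-sym a w p q) (edge-sym (pole (not ℓ')) y p q)))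
                                   (complete-sym v l p q)
    bound : ∀ k x → Away x → X (pole k) x ≤ l
    bound k x hx with edge-view (pole (not ℓ')) y (pole k) x | edge-view a w (pole k) x
    ... | inj₂ (inj₂ (e , _)) | _ = ⊥-elim (pole≢away (not ℓ') hx e)
    ... | inj₂ (inj₁ (e , refl)) | _ with pole-injective e
    ...   | refl = begin
      U (pole (not ℓ')) y + (edge a w (pole (not ℓ')) y + edge (pole (not ℓ')) y (pole (not ℓ')) y)
        ≡⟨ cong₂ (λ s t → s + (edge a w (pole (not ℓ')) y + t)) (U-at-pole (not ℓ') y hy) (edge-≡1 (pole≢away (not ℓ') hy)) ⟩
      attachG allSegments (pole (not ℓ')) y + (edge a w (pole (not ℓ')) y + 1)
        ≡⟨ sym (+-assoc (attachG allSegments (pole (not ℓ')) y) _ 1) ⟩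
      attachG allSegments (pole (not ℓ')) y + edge a w (pole (not ℓ')) y + 1
        ≤⟨ feasible ⟩
      attachG allSegments (pole ℓ') y
        ≡⟨ sym (U-at-pole ℓ' y hy) ⟩
      U (pole ℓ') y
        ≤⟨ U-at-pole≤λ ℓ' y hy ⟩
      l ∎
      where open ≤-Reasoning
    bound k x hx | inj₁ z | inj₂ (inj₂ (e , _)) = ⊥-elim (pole≢away true hx e)
    bound k x hx | inj₁ z | inj₂ (inj₁ (e , refl)) with pole-injective {true} {k} e
    ...   | refl = begin
      U a w + (edge a w a w + edge (pole (not ℓ')) y a w)
        ≡⟨ cong₂ (λ s t → U a w + (s + t)) (edge-≡1 (pole≢away true hw)) z ⟩
      U a w + 1
        ≡⟨ +-comm (U a w) 1 ⟩
      suc (U a w)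
        ≤⟨ U<U ⟩
      U b w
        ≤⟨ U-at-pole≤λ false w hw ⟩
      l ∎
      where open ≤-Reasoning
    bound k x hx | inj₁ z | inj₁ z' rewrite z | z' = subst (_≤ l) (sym (+-identityʳ (U (pole k) x))) (U-at-pole≤λ k x hx)
    at-pole : ∀ k x → Away x → X (pole k) x ≤ K (pole k) x
    at-pole k x hx = subst (X (pole k) x ≤_) (sym (complete-≢ v l (pole k) x (pole≢away k hx))) (bound k x hx)
    by-cases : ∀ p q → edge a w p q ≡ 0 ⊎ (a ≡ p × w ≡ q) ⊎ (a ≡ q × w ≡ p) →
      edge (pole (not ℓ')) y p q ≡ 0 ⊎ (pole (not ℓ') ≡ p × y ≡ q) ⊎ (pole (not ℓ') ≡ q × y ≡ p) → X p q ≤ K p q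
    by-cases p q (inj₁ z1) (inj₁ z2) =
      subst (_≤ K p q) (sym (trans (cong₂ (λ s t → U p q + (s + t)) z1 z2) (+-identityʳ (U p q)))) (disjoint p q)
    by-cases _ _ (inj₂ (inj₁ (refl , refl))) _ = at-pole true w hw
    by-cases _ _ (inj₂ (inj₂ (refl , refl))) _ = symmetric (at-pole true w hw)
    by-cases _ _ (inj₁ _) (inj₂ (inj₁ (refl , refl))) = at-pole (not ℓ') y hy
    by-cases _ _ (inj₁ _) (inj₂ (inj₂ (refl , refl))) = symmetric (at-pole (not ℓ') y hy)

  SwitchOutcome : Fin v → Set
  SwitchOutcome w = Σ (Packing v l M) λ P' → Σ (Fin v) λ y → Away y ×
    ((∀ p q → leave P' p q + (edge a w p q + edge a y p q) ≡ L p q + (edge b w p q + edge b y p q)) ⊎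
     (y ≢ w × (∀ p q → leave P' p q + (edge a w p q + edge b y p q) ≡ L p q + (edge b w p q + edge a y p q))))

  -- Since w has fewer edges to b than to a in the leave, more cycles use b w than a w; an alternating trail
  -- of segment flips starting at such a b-end moves one of them to a w.
  switch : ∀ w → Away w → L b w < L a w → SwitchOutcome w
  switch w hw L<L = outcome (alternatingTrail (length allSegments) allSegments refl allAway w false hw attach<attach)
    where
    allAway : AllAway allSegments
    allAway = AllAway-concatFin segmentsAt (λ i → segments-away (cycleDecomposition i))
    U<U : U a w < U b w
    U<U = ≰⇒> (λ le → <-irrefl refl (<-≤-trans L<L
            (subst₂ _≤_ (sym (L-at-pole true w hw)) (sym (L-at-pole false w hw)) (∸-monoʳ-≤ l le))))
    attach<attach : attachG allSegments a w < attachG allSegments b w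
    attach<attach = subst₂ _<_ (U-at-pole true w hw) (U-at-pole false w hw) U<U
    classify : ∀ (P' : Packing v l M) y ℓ' → Away y →
      attachG allSegments (pole (not ℓ')) y + edge a w (pole (not ℓ')) y + 1 ≤ attachG allSegments (pole ℓ') y →
      (∀ p q → leave P' p q + (edge a w p q + edge (pole (not ℓ')) y p q) ≡ L p q + (edge b w p q + edge (pole ℓ') y p q)) →
      SwitchOutcome w
    classify P' y false hy feasible eq = P' , y , hy , inj₁ eq
    classify P' y true hy feasible eq = P' , y , hy , inj₂ (y≢w , eq)
      where
      y≢w : y ≢ w
      y≢w refl = <-irrefl refl (<-≤-trans attach<attach (≤-trans (≤-trans (m≤m+n _ _) (+-monoˡ-≤ 1 (m≤m+n _ _))) feasible))
    outcome : TrailOutcome allSegments w false → SwitchOutcome w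
    outcome (Ss' , y , ℓ' , flips , hy , exchange , feasible) with Flips-concatFin⁻ segmentsAt flips
    ... | g , fg , refl with reflip g fg
    ... | cyc' , isCyc' , U'-split = classify P' y ℓ' hy feasible leave-exchanged
      where
      U' : Graph v
      U' = usedBy M cyc'
      U'-exchange : ∀ p q → U' p q + (edge b w p q + edge (pole ℓ') y p q) ≡ U p q + (edge a w p q + edge (pole (not ℓ')) y p q)
      U'-exchange p q = begin
        U' p q + (edge b w p q + edge (pole ℓ') y p q)
          ≡⟨ cong (_+ (edge b w p q + edge (pole ℓ') y p q)) (U'-split p q) ⟩
        restG p q + attachG (concatFin g) p q + (edge b w p q + edge (pole ℓ') y p q)
          ≡⟨ regroup (restG p q) _ _ _ ⟩
        restG p q + (attachG (concatFin g) p q + edge b w p q + edge (pole ℓ') y p q)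
          ≡⟨ cong (restG p q +_) (exchange p q) ⟩
        restG p q + (attachG allSegments p q + edge a w p q + edge (pole (not ℓ')) y p q)
          ≡⟨ sym (regroup (restG p q) _ _ _) ⟩
        restG p q + attachG allSegments p q + (edge a w p q + edge (pole (not ℓ')) y p q)
          ≡⟨ cong (_+ (edge a w p q + edge (pole (not ℓ')) y p q)) (sym (U-split p q)) ⟩
        U p q + (edge a w p q + edge (pole (not ℓ')) y p q) ∎
        where
        open ≡-Reasoning
        regroup : ∀ (r g x z : ℕ) → r + g + (x + z) ≡ r + (g + x + z)
        regroup = solve-∀
      disjoint' : U' ⊆ K
      disjoint' p q = ≤-trans (subst (U' p q ≤_) (U'-exchange p q) (m≤m+n (U' p q) _))
                              (added-within-λ w y ℓ' hw hy U<U feasible p q)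
      P' : Packing v l M
      P' = record { cyc = cyc' ; isCyc = isCyc' ; disjoint = disjoint' }
      leave-exchanged : ∀ p q → leave P' p q + (edge a w p q + edge (pole (not ℓ')) y p q) ≡ L p q + (edge b w p q + edge (pole ℓ') y p q)
      leave-exchanged p q = leave-exchange (K p q) (U p q) (U' p q) _ _ (disjoint p q) (disjoint' p q) (U'-exchange p q)

-- Reachability in a finite multigraph is decidable

anyFin : ∀ {n} → (Fin n → Bool) → Bool
anyFin {zero} f = false
anyFin {suc n} f = f zero ∨ anyFin (λ i → f (suc i))

anyFin-intro : ∀ {n} (f : Fin n → Bool) i → f i ≡ true → anyFin f ≡ true
anyFin-intro f zero e rewrite e = refl
anyFin-intro f (suc i) e with f zero
... | true = refl
... | false = anyFin-intro (λ j → f (suc j)) i e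

anyFin-elim : ∀ {n} (f : Fin n → Bool) → anyFin f ≡ true → ∃ λ i → f i ≡ true
anyFin-elim {suc n} f e with f zero in eq
... | true = zero , eq
... | false with anyFin-elim (λ j → f (suc j)) e
... | i , e' = suc i , e'

anyFin-false : ∀ {n} (f : Fin n → Bool) → anyFin f ≡ false → ∀ i → f i ≡ false
anyFin-false {suc n} f e zero with f zero
... | false = refl
anyFin-false {suc n} f e (suc i) with f zero
... | false = anyFin-false (λ j → f (suc j)) e i

bit : Bool → ℕ
bit true = 1
bit false = 0

size : ∀ {n} → (Fin n → Bool) → ℕ
size f = sumFin (λ x → bit (f x))

size≤ : ∀ {n} (f : Fin n → Bool) → size f ≤ n
size≤ {zero} f = z≤n
size≤ {suc n} f with f zero
... | true = s≤s (size≤ (λ i → f (suc i)))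
... | false = ≤-trans (size≤ (λ i → f (suc i))) (n≤1+n n)

size-mono : ∀ {n} (f g : Fin n → Bool) → (∀ x → f x ≡ true → g x ≡ true) → size f ≤ size g
size-mono f g h = sumFin-mono bit-mono
  where
  bit-mono : ∀ x → bit (f x) ≤ bit (g x)
  bit-mono x with f x in e1 | g x in e2
  ... | false | _ = z≤n
  ... | true | true = ≤-refl
  ... | true | false with trans (sym (h x e1)) e2
  ... | ()

size-strict : ∀ {n} (f g : Fin n → Bool) → (∀ x → f x ≡ true → g x ≡ true) → ∀ y → g y ≡ true → f y ≡ false → suc (size f) ≤ size g
size-strict {suc n} f g h zero gy fy rewrite gy | fy = s≤s (size-mono (λ i → f (suc i)) (λ i → g (suc i)) (λ x → h (suc x)))
size-strict {suc n} f g h (suc y) gy fy with f zero in e1 | g zero in e2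
... | true | true = s≤s (size-strict (λ i → f (suc i)) (λ i → g (suc i)) (λ x → h (suc x)) y gy fy)
... | false | true = ≤-trans (size-strict (λ i → f (suc i)) (λ i → g (suc i)) (λ x → h (suc x)) y gy fy) (n≤1+n _)
... | false | false = size-strict (λ i → f (suc i)) (λ i → g (suc i)) (λ x → h (suc x)) y gy fy
... | true | false with trans (sym (h zero e1)) e2
... | ()

∨-introʳ : ∀ a {b} → b ≡ true → a ∨ b ≡ true
∨-introʳ true e = refl
∨-introʳ false e = e

∨-elim : ∀ a b → a ∨ b ≡ true → a ≡ true ⊎ b ≡ true
∨-elim true b e = inj₁ refl
∨-elim false b e = inj₂ e

∧-intro : ∀ {a b} → a ≡ true → b ≡ true → a ∧ b ≡ true
∧-intro refl refl = refl

∧-elim : ∀ a b → a ∧ b ≡ true → a ≡ true × b ≡ true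
∧-elim true true e = refl , refl

module Reachability {v : ℕ} (G : Graph v) (x0 : Fin v) where
  Reached : Fin v → Set
  Reached x = Star (Adj G) x0 x

  adjacent? : Fin v → Fin v → Bool
  adjacent? y x = ⌊ 0 <? G y x ⌋

  expand : (Fin v → Bool) → Fin v → Bool
  expand f x = f x ∨ anyFin (λ y → f y ∧ adjacent? y x)

  within : ℕ → Fin v → Bool
  within zero x = ⌊ x0 ≟ x ⌋
  within (suc n) = expand (within n)

  true⇒ : ∀ {A : Set} (d : Dec A) → ⌊ d ⌋ ≡ true → A
  true⇒ (yes a) _ = a

  ⇒true : ∀ {A : Set} (d : Dec A) → A → ⌊ d ⌋ ≡ true
  ⇒true (yes _) _ = refl
  ⇒true (no n) a = ⊥-elim (n a)

  within-sound : ∀ n x → within n x ≡ true → Reached x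
  within-sound zero x e with true⇒ (x0 ≟ x) e
  ... | refl = ε
  within-sound (suc n) x e with ∨-elim (within n x) _ e
  ... | inj₁ e1 = within-sound n x e1
  ... | inj₂ e2 with anyFin-elim (λ y → within n y ∧ adjacent? y x) e2
  ... | y , e3 with ∧-elim (within n y) (adjacent? y x) e3
  ... | e4 , e5 = within-sound n y e4 ◅◅ (true⇒ (0 <? G y x) e5 ◅ ε)

  expand-⊇ : ∀ f x → f x ≡ true → expand f x ≡ true
  expand-⊇ f x e rewrite e = refl

  expand-step : ∀ f y x → f y ≡ true → Adj G y x → expand f x ≡ true
  expand-step f y x e a = ∨-introʳ (f x) (anyFin-intro (λ z → f z ∧ adjacent? z x) y (∧-intro e (⇒true (0 <? G y x) a)))

  Stable : ℕ → Set
  Stable k = ∀ x → within (suc k) x ≡ true → within k x ≡ true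

  stable? : ∀ k → Stable k ⊎ (∃ λ y → within (suc k) y ≡ true × within k y ≡ false)
  stable? k with anyFin (λ y → within (suc k) y ∧ not (within k y)) in e
  ... | false = inj₁ λ x ex → old x ex (anyFin-false _ e x)
    where
    old : ∀ x → within (suc k) x ≡ true → within (suc k) x ∧ not (within k x) ≡ false → within k x ≡ true
    old x ex e' rewrite ex with within k x
    ... | true = refl
  ... | true with anyFin-elim _ e
  ... | y , ey with ∧-elim (within (suc k) y) (not (within k y)) ey
  ... | e1 , e2 = inj₂ (y , e1 , not-true (within k y) e2)
    where
    not-true : ∀ b → not b ≡ true → b ≡ false
    not-true false _ = refl

  grow : ∀ n → (∃ λ k → Stable k) ⊎ (suc n ≤ size (within n))
  grow zero = inj₂ (≤-trans (s≤s z≤n) (size-strict (λ _ → false) (within zero) (λ x ()) x0 (⇒true (x0 ≟ x0) refl) refl))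
  grow (suc n) with grow n
  ... | inj₁ st = inj₁ st
  ... | inj₂ c with stable? n
  ... | inj₁ st = inj₁ (n , st)
  ... | inj₂ (y , e1 , e2) = inj₂ (≤-trans (s≤s c) (size-strict (within n) (within (suc n)) (expand-⊇ (within n)) y e1 e2))

  stabilises : ∃ λ k → Stable k
  stabilises with grow v
  ... | inj₁ st = st
  ... | inj₂ c = ⊥-elim (<-irrefl refl (≤-trans c (size≤ (within v))))

  k* : ℕ
  k* = proj₁ stabilises

  stable-closed : ∀ y x → within k* y ≡ true → Adj G y x → within k* x ≡ true
  stable-closed y x e a = proj₂ stabilises x (expand-step (within k*) y x e a)

  stable-complete : ∀ z x → within k* z ≡ true → Star (Adj G) z x → within k* x ≡ true
  stable-complete z .z e ε = e
  stable-complete z x e (a ◅ st) = stable-complete _ x (stable-closed z _ e a) st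

  x0-within : ∀ n → within n x0 ≡ true
  x0-within zero = ⇒true (x0 ≟ x0) refl
  x0-within (suc n) = expand-⊇ (within n) x0 (x0-within n)

  reach? : ∀ x → Dec (Reached x)
  reach? x with within k* x in e
  ... | true = yes (within-sound k* x e)
  ... | false = no λ r → not-¬ refl (trans (sym (stable-complete x0 x (x0-within k*) r)) e)

-- Shortening the chord

keepIf : ∀ {A : Set} → Dec A → ℕ → ℕ
keepIf (yes _) n = n
keepIf (no _) _ = 0

module Reduction {v l s : ℕ} {M : List ℕ} (P : Packing v l M) (H : Graph v) (x0 : Fin v)
            (comp : IsComponent (leave P) H x0) (s3 : 3 ≤ s) where

  L : Graph v
  L = leave P

  open Reachability L x0 public using (Reached; reach?)

  restrict : Graph v → Graph v
  restrict G x y = keepIf (reach? x) (G x y)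

  H≈restrict : ∀ x y → H x y ≡ restrict L x y
  H≈restrict x y with reach? x
  ... | yes r = proj₁ (comp x y) r
  ... | no nr = proj₂ (comp x y) nr

  record Invariant (P' : Packing v l M) : Set where
    constructor invariant
    field
      unreached-unchanged : ∀ x y → ¬ Reached x → leave P' x y ≡ L x y
      edgeCount-kept : edgeCount (restrict (leave P')) ≡ edgeCount (restrict L)

  DegreesKept : Packing v l M → Set
  DegreesKept P' = ∀ x → deg (leave P') x ≡ deg L x

  AllReached : List (Fin v) → Set
  AllReached z = ∀ x → x ∈ z → Reached x

  record CycleInLeave (P' : Packing v l M) (z : List (Fin v)) : Set where
    constructor cycleInLeave
    field
      distinct : Distinct z
      length-≡ : length z ≡ suc s
      reached : AllReached z
      inLeave : ∀ p q → cycleG z p q ≤ leave P' p q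

  Conclusion : Set
  Conclusion = Σ (Packing v l M) λ P' → Σ (Graph v) λ H' →
      IsMultigraph H' ×
      (∀ x y → leave P' x y ≡ (leave P x y ∸ H x y) + H' x y) ×
      (∀ x y → 1 ≤ H' x y → Reach (leave P) x0 x) ×
      (edgeCount H' ≡ edgeCount H) ×
      Σ (Fin s → Fin v) λ c → Σ (Fin s) λ j → Σ (Fin v) λ w →
        IsLassoIn H' c j w × (∀ i → deg H (c i) ≤ deg H' (c i))

  reached-closed : ∀ (P' : Packing v l M) → Invariant P' → ∀ x y → Reached x → 0 < leave P' x y → Reached y
  reached-closed P' inv x y rx pos with reach? y
  ... | yes ry = ry
  ... | no nry = ⊥-elim (nry (rx ◅◅ (subst (0 <_) e pos ◅ ε)))
    where
    e : leave P' x y ≡ L x y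
    e = trans (leave-sym P' x y) (trans (Invariant.unreached-unchanged inv y x nry) (leave-sym P y x))

  L-escape-≡0 : ∀ x y → Reached x → ¬ Reached y → L x y ≡ 0
  L-escape-≡0 x y rx nry with L x y in e
  ... | zero = refl
  ... | suc k = ⊥-elim (nry (rx ◅◅ (subst (0 <_) (sym e) (s≤s z≤n) ◅ ε)))

  leave-escape-≡0 : ∀ (P' : Packing v l M) → Invariant P' → ∀ x y → Reached x → ¬ Reached y → leave P' x y ≡ 0
  leave-escape-≡0 P' inv x y rx nry = trans (leave-sym P' x y)
    (trans (Invariant.unreached-unchanged inv y x nry) (trans (leave-sym P y x) (L-escape-≡0 x y rx nry)))

  restrict-symmetric : ∀ (P' : Packing v l M) → Invariant P' → ∀ x y → restrict (leave P') x y ≡ restrict (leave P') y x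
  restrict-symmetric P' inv x y with reach? x | reach? y
  ... | yes rx | yes ry = leave-sym P' x y
  ... | yes rx | no nry = leave-escape-≡0 P' inv x y rx nry
  ... | no nrx | yes ry = sym (leave-escape-≡0 P' inv y x ry nrx)
  ... | no nrx | no nry = refl

  restrict-diag : ∀ (P' : Packing v l M) x → restrict (leave P') x x ≡ 0
  restrict-diag P' x with reach? x
  ... | yes _ = leave-diag P' x
  ... | no _ = refl

  leave-restrict : ∀ (P' : Packing v l M) → Invariant P' → ∀ x y → leave P' x y ≡ (L x y ∸ H x y) + restrict (leave P') x y
  leave-restrict P' inv x y rewrite H≈restrict x y with reach? x
  ... | yes rx = sym (cong (_+ leave P' x y) (n∸n≡0 (L x y)))
  ... | no nrx = trans (Invariant.unreached-unchanged inv x y nrx) (sym (+-identityʳ (L x y)))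

  restrict-reached : ∀ G x y → 1 ≤ restrict G x y → Reached x
  restrict-reached G x y h with reach? x
  ... | yes rx = rx
  ... | no _ with h
  ... | ()

  deg-restrict : ∀ G x → Reached x → deg (restrict G) x ≡ deg G x
  deg-restrict G x rx = sumFin-cong (λ y → kept {y} (reach? x))
    where
    kept : ∀ {y} (d : Dec (Reached x)) → keepIf d (G x y) ≡ G x y
    kept (yes _) = refl
    kept (no n) = ⊥-elim (n rx)

  conclude : ∀ (P' : Packing v l M) → Invariant P' → ∀ u zl w →
    Distinct (u ∷ zl) → length (u ∷ zl) ≡ s → AllReached (u ∷ zl) → (∀ p q → cycleG (u ∷ zl) p q ≤ leave P' p q) →
    w ∉ u ∷ zl → 1 ≤ leave P' u w → (∀ x → x ∈ u ∷ zl → deg L x ≤ deg (leave P') x) → Conclusion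
  conclude P' inv u zl w d len reached inLeave w∉ pendant degrees-grow =
    P' , H' , (restrict-symmetric P' inv , restrict-diag P') , leave-restrict P' inv , restrict-reached (leave P') ,
    trans (Invariant.edgeCount-kept inv) (sym (edgeCount-cong H≈restrict)) ,
    c , j , w , ((s≥2 , seqOf-injective (u ∷ zl) len d) , c-in-H' , c≢w , pendant-in-H') , degrees
    where
    H' : Graph v
    H' = restrict (leave P')
    s≥2 : 2 ≤ s
    s≥2 = ≤-trans (s≤s (s≤s z≤n)) s3
    c : Fin s → Fin v
    c = seqOf (u ∷ zl) len
    j : Fin s
    j = cast len zero
    c-in-H' : cycMult c ⊆ H'
    c-in-H' p q with reach? p
    ... | yes rp = subst (_≤ leave P' p q) (sym (cycMult-seqOf (u ∷ zl) len p q)) (inLeave p q)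
    ... | no nrp = ≤-reflexive (trans (cycMult-seqOf (u ∷ zl) len p q) (cycleG-∉ˡ (u ∷ zl) (λ m → nrp (reached p m)) q))
    c≢w : ∀ i → c i ≢ w
    c≢w i e = w∉ (subst (_∈ u ∷ zl) e (seqOf-∈ (u ∷ zl) len i))
    pendant-in-H' : 1 ≤ H' (c j) w
    pendant-in-H' rewrite cast-involutive (sym len) len zero with reach? u
    ... | yes _ = pendant
    ... | no nru = ⊥-elim (nru (reached u (here refl)))
    degrees : ∀ i → deg H (c i) ≤ deg H' (c i)
    degrees i = subst₂ _≤_ (sym (trans (deg-cong H≈restrict x) (deg-restrict L x rx))) (sym (deg-restrict (leave P') x rx))
                  (degrees-grow x x∈)
      where
      x : Fin v
      x = c i
      x∈ : x ∈ u ∷ zl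
      x∈ = seqOf-∈ (u ∷ zl) len i
      rx : Reached x
      rx = reached x x∈

  chord-at-distance-2 : ∀ (P' : Packing v l M) → Invariant P' → DegreesKept P' → ∀ u0 u1 u2 U →
    CycleInLeave P' (u0 ∷ u1 ∷ u2 ∷ U) → cycleG (u0 ∷ u1 ∷ u2 ∷ U) u0 u2 < leave P' u0 u2 → Conclusion
  chord-at-distance-2 P' inv kept u0 u1 u2 U (cycleInLeave (n0 ∷ᵈ (n1 ∷ᵈ d2)) len reached inLeave) chord =
    conclude P' inv u0 (u2 ∷ U) u1 ((λ m → n0 (there m)) ∷ᵈ d2) (suc-injective len) reached′ inLeave′ u1∉ pendant
      (λ x _ → ≤-reflexive (sym (kept x)))
    where
    L' : Graph v
    L' = leave P'
    u0≢u1 : u0 ≢ u1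
    u0≢u1 e = n0 (here e)
    u0≢u2 : u0 ≢ u2
    u0≢u2 e = n0 (there (here e))
    u1≢u2 : u1 ≢ u2
    u1≢u2 e = n1 (here e)
    reached′ : AllReached (u0 ∷ u2 ∷ U)
    reached′ x (here e) = reached x (here e)
    reached′ x (there m) = reached x (there (there m))
    u1∉ : u1 ∉ u0 ∷ u2 ∷ U
    u1∉ (here e) = u0≢u1 (sym e)
    u1∉ (there m) = n1 m
    pendant : 1 ≤ L' u0 u1
    pendant = ≤-trans (≤-trans (≤-reflexive (sym (edge-≡1 u0≢u1))) (m≤m+n _ _)) (inLeave u0 u1)
    rest : Graph v
    rest = pathG (u2 ∷ U ++ [ u0 ])
    chord-used : cycleG (u0 ∷ u2 ∷ U) u0 u2 ≤ L' u0 u2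
    chord-used = subst (λ t → t + rest u0 u2 ≤ L' u0 u2) (sym (edge-≡1 u0≢u2))
      (subst₂ (λ a b → suc (a + (b + rest u0 u2)) ≤ L' u0 u2)
        (edge-≡0 (inj₂ u1≢u2) (inj₁ u0≢u2)) (edge-≡0 (inj₁ (λ e → u0≢u1 (sym e))) (inj₁ u1≢u2)) chord)
    inLeave′ : ∀ p q → cycleG (u0 ∷ u2 ∷ U) p q ≤ L' p q
    inLeave′ p q with edge-view u0 u2 p q
    ... | inj₁ z = subst (λ t → t + rest p q ≤ L' p q) (sym z)
                     (≤-trans (≤-trans (m≤n+m (rest p q) (edge u1 u2 p q)) (m≤n+m _ (edge u0 u1 p q))) (inLeave p q))
    ... | inj₂ (inj₁ (refl , refl)) = chord-used
    ... | inj₂ (inj₂ (refl , refl)) = subst₂ _≤_ (cycleG-sym (u0 ∷ u2 ∷ U) u0 u2) (leave-sym P' u0 u2) chord-used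

  CycleInLeave-↭ : ∀ {P' : Packing v l M} {z z'} → z ↭ z' → (∀ p q → cycleG z' p q ≡ cycleG z p q) → CycleInLeave P' z → CycleInLeave P' z'
  CycleInLeave-↭ perm e (cycleInLeave d len reached inLeave) = cycleInLeave
    (Distinct-↭ perm d) (trans (sym (↭-length perm)) len) (λ x m → reached x (∈-resp-↭ (↭-sym perm) m))
    (λ p q → subst (λ t → t ≤ _) (sym (e p q)) (inLeave p q))

  chord-1-3 : ∀ (P' : Packing v l M) → Invariant P' → DegreesKept P' → ∀ z0 z1 z2 z3 R' →
    CycleInLeave P' (z0 ∷ z1 ∷ z2 ∷ z3 ∷ R') → cycleG (z0 ∷ z1 ∷ z2 ∷ z3 ∷ R') z1 z3 < leave P' z1 z3 → Conclusion
  chord-1-3 P' inv kept z0 z1 z2 z3 R' cyc chord =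
    chord-at-distance-2 P' inv kept z1 z2 z3 (R' ++ [ z0 ]) (CycleInLeave-↭ {P' = P'} (++-comm [ z0 ] (z1 ∷ z2 ∷ z3 ∷ R')) e cyc)
      (subst (_< leave P' z1 z3) (sym (e z1 z3)) chord)
    where
    e : ∀ p q → cycleG (z1 ∷ z2 ∷ z3 ∷ R' ++ [ z0 ]) p q ≡ cycleG (z0 ∷ z1 ∷ z2 ∷ z3 ∷ R') p q
    e p q = sym (cycleG-rotate₁ z0 (z1 ∷ z2 ∷ z3 ∷ R') p q)

  chord-1-last : ∀ (P' : Packing v l M) → Invariant P' → DegreesKept P' → ∀ z0 z1 Z t →
    CycleInLeave P' (z0 ∷ z1 ∷ Z ++ [ t ]) → cycleG (z0 ∷ z1 ∷ Z ++ [ t ]) z1 t < leave P' z1 t → Conclusion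
  chord-1-last P' inv kept z0 z1 Z t cyc chord =
    chord-at-distance-2 P' inv kept t z0 z1 Z (CycleInLeave-↭ {P' = P'} (++-comm (z0 ∷ z1 ∷ Z) [ t ]) e cyc)
      (subst₂ _<_ (trans (cycleG-sym (z0 ∷ z1 ∷ Z ++ [ t ]) z1 t) (sym (e t z1))) (leave-sym P' z1 t) chord)
    where
    e : ∀ p q → cycleG (t ∷ z0 ∷ z1 ∷ Z) p q ≡ cycleG (z0 ∷ z1 ∷ Z ++ [ t ]) p q
    e p q = sym (cycleG-rotate (z0 ∷ z1 ∷ Z) [ t ] p q)

cycleG-second-≡0 : ∀ {v} (u x y : Fin v) rest → Distinct (u ∷ x ∷ y ∷ rest) → ∀ t → t ≢ u → t ≢ y → cycleG (u ∷ x ∷ y ∷ rest) x t ≡ 0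
cycleG-second-≡0 u x y rest (n0 ∷ᵈ (n1 ∷ᵈ d)) t tu ty =
  cong₂ _+_ (edge-≡0 {x = u} {y = x} {p = x} {q = t} (inj₁ (λ e → n0 (here e))) (inj₁ (λ e → tu (sym e))))
    (cong₂ _+_ (edge-≡0 {x = x} {y = y} {p = x} {q = t} (inj₂ (λ e → ty (sym e))) (inj₂ (λ e → n1 (here (sym e)))))
      (pathG-∉ˡ (y ∷ rest ++ [ u ]) x∉ t))
  where
  x∉ : x ∉ y ∷ rest ++ [ u ]
  x∉ (here e) = n1 (here e)
  x∉ (there m) with ∈-++⁻ rest m
  ... | inj₁ m' = n1 (there m')
  ... | inj₂ (here e) = n0 (here (sym e))

exchange-cancel : ∀ {v} {g g' : ℕ} (A B C D : Graph v) p q → g + (A p q + B p q) ≡ g' + (C p q + D p q) →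
  A p q ≡ 0 → B p q ≡ 0 → C p q ≡ 0 → D p q ≡ 0 → g ≡ g'
exchange-cancel {g = g} {g'} A B C D p q e a≡0 b≡0 c≡0 d≡0 = begin
  g                           ≡⟨ sym (+-identityʳ g) ⟩
  g + (0 + 0)                 ≡⟨ cong₂ (λ a b → g + (a + b)) (sym a≡0) (sym b≡0) ⟩
  g + (A p q + B p q)         ≡⟨ e ⟩
  g' + (C p q + D p q)        ≡⟨ cong₂ (λ c d → g' + (c + d)) c≡0 d≡0 ⟩
  g' + (0 + 0)                ≡⟨ +-identityʳ g' ⟩
  g'                          ∎
  where open ≡-Reasoning

exchange-pos : ∀ {v} {g g' : ℕ} (A B C D : Graph v) p q → g + (A p q + B p q) ≡ g' + (C p q + D p q) →
  B p q ≡ 1 → C p q ≡ 0 → D p q ≡ 0 → 0 < g'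
exchange-pos {g = g} {g'} A B C D p q e b≡1 c≡0 d≡0 =
  subst (0 <_) (trans e (trans (cong₂ (λ c d → g' + (c + d)) c≡0 d≡0) (+-identityʳ g')))
    (subst (λ b → 0 < g + (A p q + b)) (sym b≡1) (≤-trans (m≤n+m 1 (A p q)) (m≤n+m (A p q + 1) g)))

exchange-≤ : ∀ g k c d e → g + (0 + c + (0 + d)) ≡ k + (e + c + (e + d)) → k ≤ g
exchange-≤ g k c d e h =
  +-cancelʳ-≤ (c + d) k g (≤-trans (+-monoʳ-≤ k (+-mono-≤ (m≤n+m c e) (m≤n+m d e))) (≤-reflexive (sym h)))

exchange-≡ : ∀ g k a b c d → g + (a + b + (c + d)) ≡ k + (c + b + (a + d)) → g ≡ k
exchange-≡ g k a b c d h = +-cancelʳ-≡ (a + b + (c + d)) g k (trans h (cong (k +_) (reorder a b c d)))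
  where
  reorder : ∀ (a b c d : ℕ) → c + b + (a + d) ≡ a + b + (c + d)
  reorder = solve-∀

-- The old leave contains the path c₁ c₂ ⋯ (weights c1, c2, rest); the exchange removes x1 = c1 and an
-- edge x2 absent from that path, and adds y1, so y1 + rest still fits into the new leave.
exchange-keeps-path : ∀ l2 lc x1 x2 y1 y2 c2 rest → l2 + (x1 + x2) ≡ lc + (y1 + y2) → x1 + (c2 + rest) ≤ lc → x2 ≡ 0 →
  y1 + rest ≤ l2
exchange-keeps-path l2 lc x1 _ y1 y2 c2 rest e h refl = +-cancelʳ-≤ x1 (y1 + rest) l2 (begin
  y1 + rest + x1                  ≡⟨ reorder y1 rest x1 ⟩
  x1 + rest + y1                  ≤⟨ +-mono-≤ (+-monoʳ-≤ x1 (m≤n+m rest c2)) (m≤m+n y1 y2) ⟩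
  x1 + (c2 + rest) + (y1 + y2)    ≤⟨ +-monoˡ-≤ (y1 + y2) h ⟩
  lc + (y1 + y2)                  ≡⟨ sym e ⟩
  l2 + (x1 + 0)                   ≡⟨ cong (l2 +_) (+-identityʳ x1) ⟩
  l2 + x1                         ∎)
  where
  open ≤-Reasoning
  reorder : ∀ (a b c : ℕ) → a + b + c ≡ c + b + a
  reorder = solve-∀

exchange-keeps-swapped : ∀ l2 lc aw bz bw az wa ab rest ba wb → l2 + (aw + bz) ≡ lc + (bw + az) → wa + (ab + (bz + rest)) ≤ lc →
  wa ≡ aw → ba ≡ ab → wb ≡ bw → ba + (az + (rest + wb)) ≤ l2
exchange-keeps-swapped l2 lc aw bz bw az _ ab rest _ _ e h refl refl refl =
  +-cancelʳ-≤ (aw + bz) _ l2 (≤-trans (≤-reflexive (reorder aw bz bw az ab rest)) (≤-trans (+-monoˡ-≤ (bw + az) h) (≤-reflexive (sym e))))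
  where
  reorder : ∀ (aw bz bw az ab rest : ℕ) → ab + (az + (rest + bw)) + (aw + bz) ≡ aw + (ab + (bz + rest)) + (bw + az)
  reorder = solve-∀

module Swap {v l s : ℕ} {M : List ℕ} (P : Packing v l M) (H : Graph v) (x0 : Fin v)
            (comp : IsComponent (leave P) H x0) (s3 : 3 ≤ s) where
  open Reduction P H x0 comp s3

  edge-unreached : ∀ {u t x} y → Reached u → Reached t → ¬ Reached x → edge u t x y ≡ 0
  edge-unreached {u} {t} {x} y ru rt nrx = edge-≡0 (inj₁ (λ e → nrx (subst Reached e ru))) (inj₂ (λ e → nrx (subst Reached e rt)))

  Invariant-step : ∀ (Pc P'' : Packing v l M) → Invariant Pc → ∀ x1 y1 x2 y2 x3 y3 x4 y4 →
    Reached x1 → Reached y1 → Reached x2 → Reached y2 → Reached x3 → Reached y3 → Reached x4 → Reached y4 →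
    x1 ≢ y1 → x2 ≢ y2 → x3 ≢ y3 → x4 ≢ y4 →
    (∀ p q → leave P'' p q + (edge x1 y1 p q + edge x2 y2 p q) ≡ leave Pc p q + (edge x3 y3 p q + edge x4 y4 p q)) → Invariant P''
  Invariant-step Pc P'' (invariant i1 i2) x1 y1 x2 y2 x3 y3 x4 y4 r1 r1' r2 r2' r3 r3' r4 r4' n1 n2 n3 n4 eq =
    invariant unchanged kept
    where
    unchanged : ∀ x y → ¬ Reached x → leave P'' x y ≡ L x y
    unchanged x y nrx = trans (exchange-cancel (edge x1 y1) (edge x2 y2) (edge x3 y3) (edge x4 y4) x y (eq x y)
      (edge-unreached y r1 r1' nrx) (edge-unreached y r2 r2' nrx) (edge-unreached y r3 r3' nrx) (edge-unreached y r4 r4' nrx))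
      (i1 x y nrx)
    restricted : restrict (leave P'') ⊕ (edge x1 y1 ⊕ edge x2 y2) ≈ restrict (leave Pc) ⊕ (edge x3 y3 ⊕ edge x4 y4)
    restricted p q with reach? p
    ... | yes _ = eq p q
    ... | no nrp rewrite edge-unreached q r1 r1' nrp | edge-unreached q r2 r2' nrp
                       | edge-unreached q r3 r3' nrp | edge-unreached q r4 r4' nrp = refl
    plus-two : ∀ G (a b c d : Fin v) → a ≢ b → c ≢ d → edgeCount (G ⊕ (edge a b ⊕ edge c d)) ≡ edgeCount G + 2
    plus-two G a b c d ab cd = trans (edgeCount-⊕ G _)
      (cong (edgeCount G +_) (trans (edgeCount-⊕ (edge a b) (edge c d)) (cong₂ _+_ (edgeCount-edge a b ab) (edgeCount-edge c d cd))))
    kept : edgeCount (restrict (leave P'')) ≡ edgeCount (restrict L)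
    kept = trans (+-cancelʳ-≡ 2 _ _ (trans (sym (plus-two _ x1 y1 x2 y2 n1 n2))
                   (trans (edgeCount-cong restricted) (plus-two _ x3 y3 x4 y4 n3 n4)))) i2

  deg-exchange : ∀ (G K : Graph v) (x1 y1 x2 y2 x3 y3 x4 y4 : Fin v) →
    (∀ p q → G p q + (edge x1 y1 p q + edge x2 y2 p q) ≡ K p q + (edge x3 y3 p q + edge x4 y4 p q)) → ∀ z →
    deg G z + ((ind (x1 ≟ z) + ind (y1 ≟ z)) + (ind (x2 ≟ z) + ind (y2 ≟ z))) ≡
    deg K z + ((ind (x3 ≟ z) + ind (y3 ≟ z)) + (ind (x4 ≟ z) + ind (y4 ≟ z)))
  deg-exchange G K x1 y1 x2 y2 x3 y3 x4 y4 eq z = begin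
    deg G z + ((ind (x1 ≟ z) + ind (y1 ≟ z)) + (ind (x2 ≟ z) + ind (y2 ≟ z)))
      ≡⟨ cong (deg G z +_) (sym (deg-two x1 y1 x2 y2)) ⟩
    deg G z + deg (edge x1 y1 ⊕ edge x2 y2) z
      ≡⟨ sym (deg-⊕ G (edge x1 y1 ⊕ edge x2 y2) z) ⟩
    deg (G ⊕ (edge x1 y1 ⊕ edge x2 y2)) z
      ≡⟨ deg-cong {G = G ⊕ (edge x1 y1 ⊕ edge x2 y2)} {K = K ⊕ (edge x3 y3 ⊕ edge x4 y4)} eq z ⟩
    deg (K ⊕ (edge x3 y3 ⊕ edge x4 y4)) z
      ≡⟨ deg-⊕ K (edge x3 y3 ⊕ edge x4 y4) z ⟩
    deg K z + deg (edge x3 y3 ⊕ edge x4 y4) z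
      ≡⟨ cong (deg K z +_) (deg-two x3 y3 x4 y4) ⟩
    deg K z + ((ind (x3 ≟ z) + ind (y3 ≟ z)) + (ind (x4 ≟ z) + ind (y4 ≟ z))) ∎
    where
    open ≡-Reasoning
    deg-two : ∀ a b c d → deg (edge a b ⊕ edge c d) z ≡ (ind (a ≟ z) + ind (b ≟ z)) + (ind (c ≟ z) + ind (d ≟ z))
    deg-two a b c d = trans (deg-⊕ (edge a b) (edge c d) z) (cong₂ _+_ (deg-edge a b z) (deg-edge c d z))

  SwapOutcome : Packing v l M → Fin v → Fin v → Fin v → Fin v → List (Fin v) → Set
  SwapOutcome Pc z0 z1 z2 z3 R' = Conclusion ⊎ Σ (Packing v l M) λ P'' →
    Invariant P'' × DegreesKept P'' × CycleInLeave P'' (z2 ∷ z1 ∷ z3 ∷ R' ++ [ z0 ]) ×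
    (∀ p q → leave P'' p q + (edge z1 z0 p q + edge z2 z3 p q) ≡ leave Pc p q + (edge z2 z0 p q + edge z1 z3 p q))

  module Neighbours (Pc : Packing v l M) (inv : Invariant Pc) (kept : DegreesKept Pc) (z0 z1 z2 z3 : Fin v) (R' : List (Fin v))
                    (cyc : CycleInLeave Pc (z0 ∷ z1 ∷ z2 ∷ z3 ∷ R')) (no-chord : leave Pc z2 z0 ≡ 0) where
    open CycleInLeave cyc

    Lc : Graph v
    Lc = leave Pc

    n0 : z0 ∉ z1 ∷ z2 ∷ z3 ∷ R'
    n0 = Distinct-head distinct
    n1 : z1 ∉ z2 ∷ z3 ∷ R'
    n1 = Distinct-head (Distinct-tail distinct)
    z0≢z1 : z0 ≢ z1
    z0≢z1 e = n0 (here e)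
    z0≢z2 : z0 ≢ z2
    z0≢z2 e = n0 (there (here e))
    z1≢z2 : z1 ≢ z2
    z1≢z2 e = n1 (here e)
    ≢-sym : ∀ {x y : Fin v} → x ≢ y → y ≢ x
    ≢-sym n e = n (sym e)
    r0 : Reached z0
    r0 = reached z0 (here refl)
    r1 : Reached z1
    r1 = reached z1 (there (here refl))
    r2 : Reached z2
    r2 = reached z2 (there (there (here refl)))

    z1-has-z0 : Lc z2 z0 < Lc z1 z0
    z1-has-z0 = subst (_< Lc z1 z0) (sym no-chord)
      (≤-trans (≤-trans (≤-reflexive (sym (trans (edge-sym z0 z1 z1 z0) (edge-≡1 z0≢z1)))) (m≤m+n _ _)) (inLeave z1 z0))

    shortened : List (Fin v)
    shortened = z0 ∷ z2 ∷ z3 ∷ R'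

    shortened-distinct : Distinct shortened
    shortened-distinct = (λ m → n0 (there m)) ∷ᵈ Distinct-tail (Distinct-tail distinct)

    z1∉shortened : z1 ∉ shortened
    z1∉shortened (here e) = z0≢z1 (sym e)
    z1∉shortened (there m) = n1 m

    rest : Graph v
    rest = pathG (z2 ∷ z3 ∷ R' ++ [ z0 ])

    cycle-from-z1 : ∀ p q → edge z1 z0 p q + (edge z1 z2 p q + rest p q) ≤ Lc p q
    cycle-from-z1 p q = subst (λ t → t + (edge z1 z2 p q + rest p q) ≤ Lc p q) (edge-comm z0 z1 p q) (inLeave p q)

    z2z1-in-leave : 1 ≤ Lc z2 z1
    z2z1-in-leave = ≤-trans (≤-trans (≤-reflexive (sym (trans (edge-sym z1 z2 z2 z1) (edge-≡1 z1≢z2))))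
                      (≤-trans (m≤m+n (edge z1 z2 z2 z1) (rest z2 z1)) (m≤n+m _ (edge z0 z1 z2 z1)))) (inLeave z2 z1)

    lasso-at-z2 : ∀ (P'' : Packing v l M) → Invariant P'' → (∀ p q → cycleG shortened p q ≤ leave P'' p q) →
      1 ≤ leave P'' z2 z1 → (∀ x → x ∈ shortened → deg L x ≤ deg (leave P'') x) → Conclusion
    lasso-at-z2 P'' inv'' inLeave'' pendant degrees =
      conclude P'' inv'' z2 (z3 ∷ R' ++ [ z0 ]) z1 (Distinct-↭ rotation shortened-distinct)
        (trans (sym (↭-length rotation)) (suc-injective length-≡))
        (λ x m → reached′ x (∈-resp-↭ (↭-sym rotation) m))
        (λ p q → subst (_≤ leave P'' p q) (cycleG-rotate₁ z0 (z2 ∷ z3 ∷ R') p q) (inLeave'' p q))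
        (λ m → z1∉shortened (∈-resp-↭ (↭-sym rotation) m)) pendant
        (λ x m → degrees x (∈-resp-↭ (↭-sym rotation) m))
      where
      rotation : shortened ↭ z2 ∷ z3 ∷ R' ++ [ z0 ]
      rotation = ++-comm [ z0 ] (z2 ∷ z3 ∷ R')
      reached′ : AllReached shortened
      reached′ x (here e) = reached x (here e)
      reached′ x (there m) = reached x (there (there m))

    moved-both : ∀ (P'' : Packing v l M) y → y ≢ z1 → y ≢ z2 →
      (∀ p q → leave P'' p q + (edge z1 z0 p q + edge z1 y p q) ≡ Lc p q + (edge z2 z0 p q + edge z2 y p q)) → Conclusion
    moved-both P'' y y≢z1 y≢z2 exchange = lasso-at-z2 P'' inv'' inLeave'' pendant degrees
      where
      ry : Reached y
      ry = reached-closed Pc inv z1 y r1 (exchange-pos {g = leave P'' z1 y} (edge z1 z0) (edge z1 y) (edge z2 z0) (edge z2 y) z1 y (exchange z1 y)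
             (edge-≡1 (≢-sym y≢z1)) (edge-≡0 (inj₁ (≢-sym z1≢z2)) (inj₁ (≢-sym y≢z2))) (edge-≡0 (inj₁ (≢-sym z1≢z2)) (inj₁ (≢-sym y≢z2))))
      inv'' : Invariant P''
      inv'' = Invariant-step Pc P'' inv z1 z0 z1 y z2 z0 z2 y r1 r0 r1 ry r2 r0 r2 ry
                (≢-sym z0≢z1) (≢-sym y≢z1) (≢-sym z0≢z2) (≢-sym y≢z2) exchange
      inLeave'' : ∀ p q → cycleG shortened p q ≤ leave P'' p q
      inLeave'' p q with edge-view z1 y p q
      ... | inj₁ z = subst (λ t → t + rest p q ≤ leave P'' p q) (edge-comm z2 z0 p q)
                       (exchange-keeps-path (leave P'' p q) (Lc p q) (edge z1 z0 p q) (edge z1 y p q) (edge z2 z0 p q) (edge z2 y p q)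
                          (edge z1 z2 p q) (rest p q) (exchange p q) (cycle-from-z1 p q) z)
      ... | inj₂ (inj₁ (refl , refl)) = ≤-trans (≤-reflexive (cycleG-∉ˡ shortened z1∉shortened y)) z≤n
      ... | inj₂ (inj₂ (refl , refl)) = ≤-trans (≤-reflexive (cycleG-∉ʳ shortened z1∉shortened y)) z≤n
      pendant : 1 ≤ leave P'' z2 z1
      pendant = subst (1 ≤_) (sym (exchange-cancel (edge z1 z0) (edge z1 y) (edge z2 z0) (edge z2 y) z2 z1 (exchange z2 z1)
                  (edge-≡0 (inj₁ z1≢z2) (inj₂ z0≢z2)) (edge-≡0 (inj₁ z1≢z2) (inj₂ y≢z2))
                  (edge-≡0 (inj₂ z0≢z1) (inj₁ (≢-sym z1≢z2))) (edge-≡0 (inj₂ y≢z1) (inj₁ (≢-sym z1≢z2))))) z2z1-in-leave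
      degrees : ∀ x → x ∈ shortened → deg L x ≤ deg (leave P'') x
      degrees x m = subst (_≤ deg (leave P'') x) (kept x)
        (exchange-≤ (deg (leave P'') x) (deg Lc x) (ind (z0 ≟ x)) (ind (y ≟ x)) (ind (z2 ≟ x))
          (subst (λ t → deg (leave P'') x + (t + ind (z0 ≟ x) + (t + ind (y ≟ x))) ≡
                        deg Lc x + (ind (z2 ≟ x) + ind (z0 ≟ x) + (ind (z2 ≟ x) + ind (y ≟ x))))
                 (ind-no (z1 ≟ x) (λ e → z1∉shortened (subst (_∈ shortened) (sym e) m)))
                 (deg-exchange (leave P'') Lc z1 z0 z1 y z2 z0 z2 y exchange x)))

    swapped : List (Fin v)
    swapped = z2 ∷ z1 ∷ z3 ∷ R' ++ [ z0 ]

    swapped-split : ∀ p q → cycleG swapped p q ≡ edge z2 z1 p q + (edge z1 z3 p q + (pathG (z3 ∷ R' ++ [ z0 ]) p q + edge z0 z2 p q))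
    swapped-split p q = cong (λ t → edge z2 z1 p q + (edge z1 z3 p q + t))
      (trans (pathG-∷ʳ z3 (R' ++ [ z0 ]) z2 p q) (cong (λ u → pathG (z3 ∷ R' ++ [ z0 ]) p q + edge u z2 p q) (lastOf-∷ʳ z3 R' z0)))

    swapped-in-leave : ∀ (P'' : Packing v l M) →
      (∀ p q → leave P'' p q + (edge z1 z0 p q + edge z2 z3 p q) ≡ Lc p q + (edge z2 z0 p q + edge z1 z3 p q)) →
      CycleInLeave P'' swapped
    swapped-in-leave P'' exchange = cycleInLeave (Distinct-↭ swap distinct) (trans (sym (↭-length swap)) length-≡)
      (λ x m → reached x (∈-resp-↭ (↭-sym swap) m))
      λ p q → subst (_≤ leave P'' p q) (sym (swapped-split p q))
        (exchange-keeps-swapped (leave P'' p q) (Lc p q) (edge z1 z0 p q) (edge z2 z3 p q) (edge z2 z0 p q) (edge z1 z3 p q)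
           (edge z0 z1 p q) (edge z1 z2 p q) (pathG (z3 ∷ R' ++ [ z0 ]) p q) (edge z2 z1 p q) (edge z0 z2 p q)
           (exchange p q) (inLeave p q) (edge-comm z0 z1 p q) (edge-comm z2 z1 p q) (edge-comm z0 z2 p q))
      where
      swap : z0 ∷ z1 ∷ z2 ∷ z3 ∷ R' ↭ swapped
      swap = P.trans (++-comm [ z0 ] (z1 ∷ z2 ∷ z3 ∷ R')) (P.swap z1 z2 ↭-refl)

    exchanged : ∀ (P'' : Packing v l M) y → y ≢ z1 → y ≢ z2 → y ≢ z0 →
      (∀ p q → leave P'' p q + (edge z1 z0 p q + edge z2 y p q) ≡ Lc p q + (edge z2 z0 p q + edge z1 y p q)) →
      SwapOutcome Pc z0 z1 z2 z3 R'
    exchanged P'' y y≢z1 y≢z2 y≢z0 exchange = by-z3 (y ≟ z3)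
      where
      ry : Reached y
      ry = reached-closed Pc inv z2 y r2 (exchange-pos {g = leave P'' z2 y} (edge z1 z0) (edge z2 y) (edge z2 z0) (edge z1 y) z2 y (exchange z2 y)
             (edge-≡1 (≢-sym y≢z2)) (edge-≡0 (inj₂ (≢-sym y≢z0)) (inj₁ (≢-sym y≢z2))) (edge-≡0 (inj₁ z1≢z2) (inj₁ (≢-sym y≢z1))))
      inv'' : Invariant P''
      inv'' = Invariant-step Pc P'' inv z1 z0 z2 y z2 z0 z1 y r1 r0 r2 ry r2 r0 r1 ry
                (≢-sym z0≢z1) (≢-sym y≢z2) (≢-sym z0≢z2) (≢-sym y≢z1) exchange
      kept'' : DegreesKept P''
      kept'' x = trans (exchange-≡ (deg (leave P'') x) (deg Lc x) (ind (z1 ≟ x)) (ind (z0 ≟ x)) (ind (z2 ≟ x)) (ind (y ≟ x))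
                          (deg-exchange (leave P'') Lc z1 z0 z2 y z2 z0 z1 y exchange x)) (kept x)
      pendant : 1 ≤ leave P'' z2 z1
      pendant = subst (1 ≤_) (sym (exchange-cancel (edge z1 z0) (edge z2 y) (edge z2 z0) (edge z1 y) z2 z1 (exchange z2 z1)
                  (edge-≡0 (inj₁ z1≢z2) (inj₂ z0≢z2)) (edge-≡0 (inj₂ y≢z1) (inj₁ (≢-sym z1≢z2)))
                  (edge-≡0 (inj₂ z0≢z1) (inj₁ (≢-sym z1≢z2))) (edge-≡0 (inj₁ z1≢z2) (inj₂ y≢z2)))) z2z1-in-leave
      inLeave'' : y ≢ z3 → ∀ p q → cycleG shortened p q ≤ leave P'' p q
      inLeave'' y≢z3 p q with edge-view z2 y p q
      ... | inj₁ z = subst (λ t → t + rest p q ≤ leave P'' p q) (edge-comm z2 z0 p q)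
                       (exchange-keeps-path (leave P'' p q) (Lc p q) (edge z1 z0 p q) (edge z2 y p q) (edge z2 z0 p q) (edge z1 y p q)
                          (edge z1 z2 p q) (rest p q) (exchange p q) (cycle-from-z1 p q) z)
      ... | inj₂ (inj₁ (refl , refl)) = ≤-trans (≤-reflexive (cycleG-second-≡0 z0 z2 z3 R' shortened-distinct y y≢z0 y≢z3)) z≤n
      ... | inj₂ (inj₂ (refl , refl)) =
        ≤-trans (≤-reflexive (trans (cycleG-sym shortened y z2) (cycleG-second-≡0 z0 z2 z3 R' shortened-distinct y y≢z0 y≢z3))) z≤n
      by-z3 : Dec (y ≡ z3) → SwapOutcome Pc z0 z1 z2 z3 R'
      by-z3 (yes e) = inj₂ (P'' , inv'' , kept'' , swapped-in-leave P'' exchange′ , exchange′)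
        where
        exchange′ : ∀ p q → leave P'' p q + (edge z1 z0 p q + edge z2 z3 p q) ≡ Lc p q + (edge z2 z0 p q + edge z1 z3 p q)
        exchange′ = subst (λ t → ∀ p q → leave P'' p q + (edge z1 z0 p q + edge z2 t p q) ≡ Lc p q + (edge z2 z0 p q + edge z1 t p q)) e exchange
      by-z3 (no y≢z3) = inj₁ (lasso-at-z2 P'' inv'' (inLeave'' y≢z3) pendant (λ x _ → ≤-reflexive (sym (kept'' x))))

    outcome : SwapOutcome Pc z0 z1 z2 z3 R'
    outcome with Switching.switch Pc z1 z2 z1≢z2 z0 (z0≢z1 , z0≢z2) z1-has-z0
    ... | P'' , y , (y≢z1 , y≢z2) , inj₁ exchange = inj₁ (moved-both P'' y y≢z1 y≢z2 exchange)
    ... | P'' , y , (y≢z1 , y≢z2) , inj₂ (y≢z0 , exchange) = exchanged P'' y y≢z1 y≢z2 y≢z0 exchange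

  swap-neighbours : ∀ (Pc : Packing v l M) → Invariant Pc → DegreesKept Pc → ∀ z0 z1 z2 z3 R' →
    CycleInLeave Pc (z0 ∷ z1 ∷ z2 ∷ z3 ∷ R') → leave Pc z2 z0 ≡ 0 → SwapOutcome Pc z0 z1 z2 z3 R'
  swap-neighbours Pc inv kept z0 z1 z2 z3 R' cyc no-chord = Neighbours.outcome Pc inv kept z0 z1 z2 z3 R' cyc no-chord

module Shorten {v l s : ℕ} {M : List ℕ} (P : Packing v l M) (H : Graph v) (x0 : Fin v)
            (comp : IsComponent (leave P) H x0) (s3 : 3 ≤ s) where
  open Reduction P H x0 comp s3
  open Swap P H x0 comp s3

  cycleG-skip-≡0 : ∀ z0 z1 z2 z3 R' → Distinct (z0 ∷ z1 ∷ z2 ∷ z3 ∷ R') → cycleG (z0 ∷ z1 ∷ z2 ∷ z3 ∷ R') z0 z2 ≡ 0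
  cycleG-skip-≡0 z0 z1 z2 z3 R' (n0 ∷ᵈ (n1 ∷ᵈ (n2 ∷ᵈ (n3 ∷ᵈ dR)))) =
    cong₂ _+_ (edge-≡0 {v} (inj₂ (λ e → n1 (here e))) (inj₁ (λ e → n0 (there (here e)))))
      (cong₂ _+_ (edge-≡0 {v} (inj₁ (λ e → n0 (here (sym e)))) (inj₁ (λ e → n1 (here e))))
        (cong₂ _+_ (edge-≡0 {v} (inj₁ (λ e → n0 (there (here (sym e))))) (inj₂ (λ e → n0 (there (there (here (sym e)))))))
          (pathG-∉ʳ (z3 ∷ R' ++ [ z0 ]) z2∉ z0)))
    where
    z2∉ : z2 ∉ z3 ∷ R' ++ [ z0 ]
    z2∉ (here e) = n2 (here e)
    z2∉ (there m) with ∈-++⁻ R' m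
    ... | inj₁ m' = n2 (there m')
    ... | inj₂ (here e) = n0 (there (here (sym e)))

  swap-unless-chord : ∀ (Pc : Packing v l M) → Invariant Pc → DegreesKept Pc → ∀ z0 z1 z2 z3 R' →
    CycleInLeave Pc (z0 ∷ z1 ∷ z2 ∷ z3 ∷ R') → SwapOutcome Pc z0 z1 z2 z3 R'
  swap-unless-chord Pc inv kept z0 z1 z2 z3 R' cyc with cycleG (z0 ∷ z1 ∷ z2 ∷ z3 ∷ R') z0 z2 <? leave Pc z0 z2
  ... | yes chord = inj₁ (chord-at-distance-2 Pc inv kept z0 z1 z2 (z3 ∷ R') cyc chord)
  ... | no ¬chord = swap-neighbours Pc inv kept z0 z1 z2 z3 R' cyc (trans (leave-sym Pc z2 z0) (n≤0⇒n≡0 no-edge))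
    where
    no-edge : leave Pc z0 z2 ≤ 0
    no-edge = subst (leave Pc z0 z2 ≤_) (cycleG-skip-≡0 z0 z1 z2 z3 R' (CycleInLeave.distinct cyc)) (≮⇒≥ ¬chord)

  -- After swapping z1 and z2 the doubled edge z1 z0 becomes a chord at distance 2.
  parallel-chord : ∀ (Pc : Packing v l M) → Invariant Pc → DegreesKept Pc → ∀ z0 z1 z2 z3 R' →
    CycleInLeave Pc (z0 ∷ z1 ∷ z2 ∷ z3 ∷ R') → cycleG (z0 ∷ z1 ∷ z2 ∷ z3 ∷ R') z1 z0 < leave Pc z1 z0 → Conclusion
  parallel-chord Pc inv kept z0 z1 z2 z3 R' cyc@(cycleInLeave (n0 ∷ᵈ (n1 ∷ᵈ _)) _ _ _) chord
    with swap-unless-chord Pc inv kept z0 z1 z2 z3 R' cyc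
  ... | inj₁ c = c
  ... | inj₂ (P'' , inv'' , kept'' , cyc''@(cycleInLeave d'' _ _ _) , exchange) =
    chord-1-last P'' inv'' kept'' z2 z1 (z3 ∷ R') z0 cyc''
      (subst (_< leave P'' z1 z0) (sym (cycleG-second-≡0 z2 z1 z3 (R' ++ [ z0 ]) d'' z0 (λ e → n0 (there (here e))) (λ e → n0 (there (there (here e))))))
        (still-positive (exchange z1 z0)
          (edge-≡1 (λ e → n0 (here (sym e))))
          (edge-≡0 (inj₁ (λ e → n1 (here (sym e)))) (inj₁ (λ e → n0 (there (here (sym e))))))
          (edge-≡0 (inj₁ (λ e → n1 (here (sym e)))) (inj₁ (λ e → n0 (there (here (sym e))))))
          (edge-≡0 (inj₂ (λ e → n0 (there (there (here (sym e)))))) (inj₁ (λ e → n0 (here (sym e)))))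
          (≤-trans (s≤s (≤-trans (≤-reflexive (sym (trans (edge-sym z0 z1 z1 z0) (edge-≡1 (λ e → n0 (here e)))))) (m≤m+n _ _))) chord)))
    where
    still-positive : ∀ {a b x1 x2 x3 x4} → a + (x1 + x2) ≡ b + (x3 + x4) → x1 ≡ 1 → x2 ≡ 0 → x3 ≡ 0 → x4 ≡ 0 → 2 ≤ b → 0 < a
    still-positive {a} {b} e refl refl refl refl h =
      ≤-pred {1} {a} (subst (2 ≤_) (+-comm a 1) (subst (2 ≤_) (sym (trans e (+-identityʳ b))) h))

  -- Each swap of z1 and z2 moves the far end t of the chord z1 t one step closer along the cycle.
  shorten-chord : ∀ pre (Pc : Packing v l M) → Invariant Pc → DegreesKept Pc → ∀ z0 z1 z2 z3 t post →
    CycleInLeave Pc (z0 ∷ z1 ∷ z2 ∷ z3 ∷ pre ++ t ∷ post) → cycleG (z0 ∷ z1 ∷ z2 ∷ z3 ∷ pre ++ t ∷ post) z1 t < leave Pc z1 t → Conclusion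
  shorten-chord pre Pc inv kept z0 z1 z2 z3 t [] cyc chord = chord-1-last Pc inv kept z0 z1 (z2 ∷ z3 ∷ pre) t cyc chord
  shorten-chord pre Pc inv kept z0 z1 z2 z3 t (u ∷ post) cyc@(cycleInLeave (n0 ∷ᵈ (n1 ∷ᵈ (n2 ∷ᵈ (n3 ∷ᵈ _)))) _ _ _) chord
    with swap-unless-chord Pc inv kept z0 z1 z2 z3 (pre ++ t ∷ u ∷ post) cyc
  ... | inj₁ c = c
  ... | inj₂ (P'' , inv'' , kept'' , cyc''@(cycleInLeave d'' _ _ _) , exchange) = continue pre cyc'' chord''
    where
    t≢z0 : t ≢ z0
    t≢z0 e = n0 (there (there (there (∈-++⁺ʳ pre (here (sym e))))))
    t≢z1 : t ≢ z1
    t≢z1 e = n1 (there (there (∈-++⁺ʳ pre (here (sym e)))))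
    t≢z2 : t ≢ z2
    t≢z2 e = n2 (there (∈-++⁺ʳ pre (here (sym e))))
    t≢z3 : t ≢ z3
    t≢z3 e = n3 (∈-++⁺ʳ pre (here (sym e)))
    chord-kept : leave P'' z1 t ≡ leave Pc z1 t
    chord-kept = exchange-cancel (edge z1 z0) (edge z2 z3) (edge z2 z0) (edge z1 z3) z1 t (exchange z1 t)
      (edge-≡0 (inj₂ (λ e → t≢z0 (sym e))) (inj₁ (λ e → t≢z1 (sym e))))
      (edge-≡0 (inj₁ (λ e → n1 (here (sym e)))) (inj₁ (λ e → t≢z2 (sym e))))
      (edge-≡0 (inj₁ (λ e → n1 (here (sym e)))) (inj₁ (λ e → t≢z2 (sym e))))
      (edge-≡0 (inj₂ (λ e → t≢z3 (sym e))) (inj₁ (λ e → t≢z1 (sym e))))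
    chord'' : cycleG (z2 ∷ z1 ∷ z3 ∷ (pre ++ t ∷ u ∷ post) ++ [ z0 ]) z1 t < leave P'' z1 t
    chord'' = subst₂ _<_ (sym (cycleG-second-≡0 z2 z1 z3 ((pre ++ t ∷ u ∷ post) ++ [ z0 ]) d'' t t≢z2 t≢z3)) (sym chord-kept)
                (≤-trans (s≤s z≤n) chord)
    continue : ∀ pre → CycleInLeave P'' (z2 ∷ z1 ∷ z3 ∷ (pre ++ t ∷ u ∷ post) ++ [ z0 ]) →
      cycleG (z2 ∷ z1 ∷ z3 ∷ (pre ++ t ∷ u ∷ post) ++ [ z0 ]) z1 t < leave P'' z1 t → Conclusion
    continue [] cyc' chord' = chord-1-3 P'' inv'' kept'' z2 z1 z3 t (u ∷ post ++ [ z0 ]) cyc' chord'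
    continue (p ∷ pre') cyc' chord' =
      shorten-chord pre' P'' inv'' kept'' z2 z1 z3 p t (u ∷ post ++ [ z0 ])
        (subst (CycleInLeave P'') reassociate cyc') (subst (λ zs → cycleG zs z1 t < leave P'' z1 t) reassociate chord')
      where
      reassociate : z2 ∷ z1 ∷ z3 ∷ (p ∷ pre' ++ t ∷ u ∷ post) ++ [ z0 ] ≡ z2 ∷ z1 ∷ z3 ∷ p ∷ pre' ++ t ∷ u ∷ post ++ [ z0 ]
      reassociate = cong (λ r → z2 ∷ z1 ∷ z3 ∷ p ∷ r) (++-assoc pre' (t ∷ u ∷ post) [ z0 ])

  rotate : ∀ {zs zs'} → zs ↭ zs' → (∀ p q → cycleG zs' p q ≡ cycleG zs p q) → CycleInLeave P zs → ∀ {a b} →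
    cycleG zs a b < L a b → CycleInLeave P zs' × cycleG zs' a b < L a b
  rotate perm e cyc {a} {b} chord = CycleInLeave-↭ {P' = P} perm e cyc , subst (_< L a b) (sym (e a b)) chord

  ∷-∷ʳ : ∀ {A : Set} (x : A) xs → ∃₂ λ ys y → x ∷ xs ≡ ys ++ [ y ]
  ∷-∷ʳ x [] = [] , x , refl
  ∷-∷ʳ x (x' ∷ xs) with ∷-∷ʳ x' xs
  ... | ys , y , e = x ∷ ys , y , cong (x ∷_) e

  too-short : ∀ {n} → n ≡ suc s → n ≤ 3 → ⊥
  too-short refl h = <-irrefl refl (≤-trans (s≤s s3) h)

  invariant₀ : Invariant P
  invariant₀ = invariant (λ x y _ → refl) refl

  chord-anywhere : ∀ x pre t post → CycleInLeave P (x ∷ pre ++ t ∷ post) → cycleG (x ∷ pre ++ t ∷ post) x t < L x t → Conclusion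
  chord-anywhere x [] t [] (cycleInLeave _ len _ _) _ = ⊥-elim (too-short len (s≤s (s≤s z≤n)))
  chord-anywhere x [] t (a1 ∷ []) (cycleInLeave _ len _ _) _ = ⊥-elim (too-short len (s≤s (s≤s (s≤s z≤n))))
  chord-anywhere x (p1 ∷ []) t [] (cycleInLeave _ len _ _) _ = ⊥-elim (too-short len (s≤s (s≤s (s≤s z≤n))))
  chord-anywhere x [] t (a1 ∷ a2 ∷ R') cyc chord =
    parallel-chord P invariant₀ (λ _ → refl) x t a1 a2 R' cyc (subst₂ _<_ (cycleG-sym (x ∷ t ∷ a1 ∷ a2 ∷ R') x t) (leave-sym P x t) chord)
  chord-anywhere x (p1 ∷ a2 ∷ R') t [] cyc chord
    with rotate (++-comm (x ∷ p1 ∷ a2 ∷ R') [ t ]) (λ p q → sym (cycleG-rotate (x ∷ p1 ∷ a2 ∷ R') [ t ] p q)) cyc chord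
  ... | cyc' , chord' = parallel-chord P invariant₀ (λ _ → refl) t x p1 a2 R' cyc' chord'
  chord-anywhere x (p1 ∷ pre1) t (u1 ∷ post1) cyc chord with ∷-∷ʳ u1 post1
  ... | post' , u , e
    with rotate (++-comm (x ∷ p1 ∷ pre1 ++ t ∷ post') [ u ]) (λ p q → sym (cycleG-rotate (x ∷ p1 ∷ pre1 ++ t ∷ post') [ u ] p q))
                (subst (CycleInLeave P) split-last cyc) (subst (λ zs → cycleG zs x t < L x t) split-last chord)
    where
    split-last : x ∷ p1 ∷ pre1 ++ t ∷ u1 ∷ post1 ≡ (x ∷ p1 ∷ pre1 ++ t ∷ post') ++ [ u ]
    split-last = trans (cong (λ w → x ∷ p1 ∷ pre1 ++ t ∷ w) e) (cong (λ w → x ∷ p1 ∷ w) (sym (++-assoc pre1 (t ∷ post') [ u ])))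
  ... | cyc' , chord' = from-u pre1 cyc' chord'
    where
    from-u : ∀ pre1 → CycleInLeave P (u ∷ x ∷ p1 ∷ pre1 ++ t ∷ post') → cycleG (u ∷ x ∷ p1 ∷ pre1 ++ t ∷ post') x t < L x t → Conclusion
    from-u [] cyc' chord' = chord-1-3 P invariant₀ (λ _ → refl) u x p1 t post' cyc' chord'
    from-u (q ∷ pre2) cyc' chord' = shorten-chord pre2 P invariant₀ (λ _ → refl) u x p1 q t post' cyc' chord'

  chord-from : ∀ zs → CycleInLeave P zs → ∀ x t → x ∈ zs → t ∈ zs → x ≢ t → cycleG zs x t < L x t → Conclusion
  chord-from zs cyc x t x∈ t∈ x≢t chord with ∈-∃++ x∈
  ... | ys , zs' , refl with rotate (++-comm ys (x ∷ zs')) (λ p q → sym (cycleG-rotate ys (x ∷ zs') p q)) cyc chord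
  ... | cyc' , chord' with ∈-resp-↭ (++-comm ys (x ∷ zs')) t∈
  ... | here e = ⊥-elim (x≢t (sym e))
  ... | there m with ∈-∃++ m
  ...   | pre , post , e = chord-anywhere x pre t post (subst (CycleInLeave P) (cong (x ∷_) e) cyc')
                               (subst (λ zs → cycleG zs x t < L x t) (cong (x ∷_) e) chord')

  cycleG-incident : ∀ (zs : List (Fin v)) → Distinct zs → 2 ≤ length zs → ∀ x → x ∈ zs → ∃ λ y → 1 ≤ cycleG zs x y
  cycleG-incident zs d len≥2 x m with ∈-∃++ m
  ... | ys , zs' , refl = from-front (zs' ++ ys) (Distinct-↭ to-front d) (≤-trans len≥2 (≤-reflexive (↭-length to-front)))
                            (cycleG-rotate ys (x ∷ zs'))
    where
    to-front : ys ++ x ∷ zs' ↭ x ∷ zs' ++ ys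
    to-front = ++-comm ys (x ∷ zs')
    from-front : ∀ r → Distinct (x ∷ r) → 2 ≤ length (x ∷ r) → cycleG (ys ++ x ∷ zs') ≈ cycleG (x ∷ r) →
      ∃ λ y → 1 ≤ cycleG (ys ++ x ∷ zs') x y
    from-front [] _ (s≤s ()) _
    from-front (h ∷ _) (n ∷ᵈ _) _ e =
      h , subst (1 ≤_) (sym (e x h)) (≤-trans (≤-reflexive (sym (edge-≡1 (λ eq → n (here eq))))) (m≤m+n _ _))

  cycle-in-leave : (c : Fin (suc s) → Fin v) → IsCycle c → cycMult c ⊆ H → CycleInLeave P (tabulate c)
  cycle-in-leave c (c≥2 , c-injective) c-in-H = cycleInLeave d (length-tabulate c) reached inLeave
    where
    d : Distinct (tabulate c)
    d = Distinct-tabulate c c-injective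
    -- every vertex of the cycle carries an edge of H, and H vanishes outside the component
    reached : AllReached (tabulate c)
    reached x m with reach? x
    ... | yes rx = rx
    ... | no nrx with cycleG-incident (tabulate c) d (subst (2 ≤_) (sym (length-tabulate c)) c≥2) x m
    ... | y , incident = ⊥-elim (<-irrefl refl (≤-trans incident
          (≤-trans (≤-reflexive (sym (cycMult≈cycleG c x y))) (≤-trans (c-in-H x y) (≤-reflexive (proj₂ (comp x y) nrx))))))
    inLeave : ∀ p q → cycleG (tabulate c) p q ≤ L p q
    inLeave p q with reach? p
    ... | yes rp = ≤-trans (≤-reflexive (sym (cycMult≈cycleG c p q))) (≤-trans (c-in-H p q) (≤-reflexive (proj₁ (comp p q) rp)))
    ... | no nrp = ≤-trans (≤-reflexive (cycleG-∉ˡ (tabulate c) (λ m → nrp (reached p m)) q)) z≤n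

  from-chorded-cycle : HasChordedCycle H (suc s) → Conclusion
  from-chorded-cycle (c , isCycle , c-in-H , i , j , chord) =
    chord-from (tabulate c) cyc (c i) (c j) (∈-tabulate⁺ {f = c} i) (∈-tabulate⁺ {f = c} j) x≢t chord-in-L
    where
    cyc : CycleInLeave P (tabulate c)
    cyc = cycle-in-leave c isCycle c-in-H
    chord-in-L : cycleG (tabulate c) (c i) (c j) < L (c i) (c j)
    chord-in-L = subst₂ _<_ (cycMult≈cycleG c (c i) (c j)) (proj₁ (comp (c i) (c j)) (CycleInLeave.reached cyc (c i) (∈-tabulate⁺ {f = c} i))) chord
    x≢t : c i ≢ c j
    x≢t e = n≮0 (subst (cycleG (tabulate c) (c i) (c i) <_) (leave-diag P (c i))
                   (subst (λ u → cycleG (tabulate c) (c i) u < L (c i) u) (sym e) chord-in-L))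

lemma2p3 : (v s l : ℕ) (M : List ℕ) → 1 ≤ v → 1 ≤ l → 3 ≤ s →
    (P : Packing v l M) (H : Graph v) (x0 : Fin v) →
    IsComponent (leave P) H x0 → HasChordedCycle H (suc s) →
    Σ (Packing v l M) λ P' → Σ (Graph v) λ H' →
      IsMultigraph H' ×
      (∀ x y → leave P' x y ≡ (leave P x y ∸ H x y) + H' x y) ×
      (∀ x y → 1 ≤ H' x y → Reach (leave P) x0 x) ×
      (edgeCount H' ≡ edgeCount H) ×
      Σ (Fin s → Fin v) λ c → Σ (Fin s) λ j → Σ (Fin v) λ w →
        IsLassoIn H' c j w × (∀ i → deg H (c i) ≤ deg H' (c i))
lemma2p3 v s l M _ _ s3 P H x0 comp hc = Shorten.from-chorded-cycle P H x0 comp s3 hc
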